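{- Let $N\in\mathbb{N}$ be fixed. Then for all $n\geq 1$, $M_{2,N}(n) > N_{2,N}(n)$.
   Context: For a partition $\pi$: $|\pi|$ is its sum, $l(\pi)$ its largest part, $\#(\pi)$ its number of parts, $\mathrm{rank}(\pi)=l(\pi)-\#(\pi)$. $N_{S_1}(m,n)$: for $1\leq j\leq N$ consider pairs $(\pi_1,\pi_2)$ with $\pi_1$ a partition into distinct parts, empty or with all parts in $[N-j+1,N]$, and $\pi_2$ a partition with Durfee square of size $j$; weight $(-1)^{\#(\pi_1)}$, size $|\pi_1|+|\pi_2|$, rank $\mathrm{rank}(\pi_2)$; $N_{S_1}(m,n)$ is the sum over $j=1,\dots,N$ of the weighted count of such pairs of size $n$ and rank $m$. $M_{S_2}(m,n)$ is the sum of $(-1)^{\#(\pi_1)}$ over triples $(\pi_1,\pi_2,\pi_3)$ with $\pi_1$ into distinct parts, $\pi_2,\pi_3$ arbitrary partitions, all largest parts $\leq N$, $|\pi_1|+|\pi_2|+|\pi_3|=n$ and $\#(\pi_2)-\#(\pi_3)=m$. $N_{2,N}(n)=\sum_{m\in\mathbb{Z}} m^2N_{S_1}(m,n)$ and $M_{2,N}(n)=\sum_{m\in\mathbb{Z}}m^2M_{S_2}(m,n)$. -}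

module Defs where

open import Data.Nat as ℕ using (ℕ; zero; suc; _∸_; _≤_; _<_; _>_; _≥_)
open import Data.Nat.Properties as ℕP using ()
open import Data.Integer as ℤ using (ℤ; +_; 0ℤ; 1ℤ; -_)
open import Data.Integer.Properties as ℤP using ()
open import Data.List using (List; []; _∷_; map; concatMap; filter; upTo; length; foldr)
open import Data.Nat.ListAction using (sum)
open import Data.List.Relation.Unary.All using (All; all?)
open import Data.List.Relation.Unary.Linked using (Linked; linked?)
open import Data.Product using (_×_)
open import Relation.Nullary using (Dec)
open import Relation.Nullary.Decidable using (_×-dec_)
open import Relation.Binary.PropositionalEquality using (_≡_)

-- Partitions, represented as lists of parts in non-increasing order.

IsPartitionOf : ℕ → List ℕ → Set
IsPartitionOf n λ′ = Linked _≥_ λ′ × All (0 <_) λ′ × sum λ′ ≡ n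

isPartitionOf? : ∀ n λ′ → Dec (IsPartitionOf n λ′)
isPartitionOf? n λ′ = linked? ℕP._≥?_ λ′ ×-dec all? (0 ℕP.<?_) λ′ ×-dec (sum λ′ ℕP.≟ n)

candidates : ℕ → ℕ → List (List ℕ)
candidates zero    b = [] ∷ []
candidates (suc l) b = [] ∷ concatMap (λ x → map (x ∷_) (candidates l b)) (upTo (suc b))

partitions : ℕ → List (List ℕ)
partitions n = filter (isPartitionOf? n) (candidates n n)

largest : List ℕ → ℕ
largest []      = 0
largest (x ∷ _) = x

#parts : List ℕ → ℕ
#parts = length

rank : List ℕ → ℤ
rank π = + largest π ℤ.- + #parts π

-- Durfee square size: the largest j with π_j ≥ j (1-indexed). For a
-- non-increasing list this is the length of the initial run of indices i
-- with π_i ≥ i.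
durfeeFrom : ℕ → List ℕ → ℕ
durfeeFrom i []       = 0
durfeeFrom i (x ∷ xs) with suc i ℕP.≤? x
... | Relation.Nullary.yes _ = suc (durfeeFrom (suc i) xs)
... | Relation.Nullary.no  _ = 0

durfee : List ℕ → ℕ
durfee = durfeeFrom 0

Distinct : List ℕ → Set
Distinct = Linked _>_

distinct? : ∀ π → Dec (Distinct π)
distinct? = linked? ℕP._>?_

sumℤ : List ℤ → ℤ
sumℤ = foldr ℤ._+_ 0ℤ

sign : ℕ → ℤ
sign zero    = 1ℤ
sign (suc k) = - sign k

Σ≤ : ℕ → (ℕ → ℤ) → ℤ
Σ≤ n f = sumℤ (map f (upTo (suc n)))

Σ∈ : {A : Set} → List A → (A → ℤ) → ℤ
Σ∈ xs f = sumℤ (map f xs)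

-- π₁ admissible for j: distinct parts, all in [N-j+1, N]
-- (empty allowed).  Here 1 ≤ j ≤ N so N ∸ j + 1 is the true N-j+1.
S1-π₁ : ℕ → ℕ → List ℕ → Set
S1-π₁ N j π = Distinct π × All (λ x → suc (N ∸ j) ≤ x × x ≤ N) π

S1-π₁? : ∀ N j π → Dec (S1-π₁ N j π)
S1-π₁? N j π = distinct? π ×-dec all? (λ x → (suc (N ∸ j) ℕP.≤? x) ×-dec (x ℕP.≤? N)) π

NS1-j : ℕ → ℕ → ℤ → ℕ → ℤ
NS1-j N j m n =
  Σ≤ n λ k →
    Σ∈ (filter (S1-π₁? N j) (partitions k)) λ π₁ →
      Σ∈ (filter (λ π₂ → (durfee π₂ ℕP.≟ j) ×-dec (rank π₂ ℤP.≟ m)) (partitions (n ∸ k))) λ π₂ →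
        sign (#parts π₁)

NS1 : ℕ → ℤ → ℕ → ℤ
NS1 N m n = Σ∈ (map suc (upTo N)) λ j → NS1-j N j m n

Bounded : ℕ → List ℕ → Set
Bounded N = All (_≤ N)

bounded? : ∀ N π → Dec (Bounded N π)
bounded? N = all? (ℕP._≤? N)

MS2 : ℕ → ℤ → ℕ → ℤ
MS2 N m n =
  Σ≤ n λ k₁ →
    Σ≤ (n ∸ k₁) λ k₂ →
      Σ∈ (filter (λ π → distinct? π ×-dec bounded? N π) (partitions k₁)) λ π₁ →
        Σ∈ (filter (bounded? N) (partitions k₂)) λ π₂ →
          Σ∈ (filter (λ π₃ → (+ #parts π₂ ℤ.- + #parts π₃) ℤP.≟ m)
                     (filter (bounded? N) (partitions (n ∸ k₁ ∸ k₂)))) λ π₃ →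
            sign (#parts π₁)

-- Second moments.  Σ_{m ∈ ℤ}; only |m| ≤ n can contribute (|rank π₂| ≤ |π₂| ≤ n
-- and |#π₂ - #π₃| ≤ n), so we sum over m = -n, …, n.

Σrange : ℕ → (ℤ → ℤ) → ℤ
Σrange n f = Σ≤ (n ℕ.+ n) λ i → f (+ i ℤ.- + n)

N2 : ℕ → ℕ → ℤ
N2 N n = Σrange n λ m → m ℤ.* m ℤ.* NS1 N m n

M2 : ℕ → ℕ → ℤ
M2 N n = Σrange n λ m → m ℤ.* m ℤ.* MS2 N m n

module Submission where

-- F₀ j, F₁ j, F₂ j
-- are the series of partitions with parts ≤ j weighted by 1, #π and #π²;
-- F₀ j = 1/(q;q)_j.
--
--  1. Enumeration: the sums of Defs run over duplicate-free lists, so any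
--     bijection between the summation domains transports them.
--  2. Combinatorics: removing the largest part gives the recursions of F₀, F₁,
--     F₂ and the product (q^L;q) for signed distinct partitions; conjugation
--     identifies vectors with partitions; a partition with Durfee square j is
--     a j×j square, an arm α and legs β, with rank α₁ − #β.
--  3. Series forms: M₂ = (q;q)_N · PairMoment N and
--     N₂ = Σ_{j=1}^{N} (q^{N−j+1};q)_j q^{j²} PairMoment j,
--     where PairMoment j = 2 (F₂F₀ − F₁²)(j).
--  4. Identities: F₂F₀ − F₁² = F₀² · Lambert j with Lambert j = Σ_{i≤j} q^i/(1−q^i)²;
--     (q^{N−j+1};q)_j F₀ j = [N, j], a Gaussian binomial with nonnegative
--     coefficients; and F₀ N = Σ_{j=0}^{N} q^{j²} [N, j] F₀ j.
--  5. So M₂ − N₂ = 2 Lambert N (n) + 2 Σ_{j=1}^{N} ((Lambert N − Lambert j) q^{j²}[N,j] F₀ j)(n),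
--     where the first term is ≥ 2n > 0 and the others are ≥ 0.

open import Defs
open import Data.Nat using (ℕ; _≤_)
open import Data.Integer using (_<_)

open import Data.Nat as ℕ using (zero; suc; _≥_; _>_; z≤n; s≤s; _∸_; pred)
import Data.Nat.Properties as ℕP
open import Data.Nat.ListAction using (sum)
import Data.Nat.ListAction.Properties as SumP
import Data.Nat.Tactic.RingSolver as ℕ-Ring
open import Data.Integer as ℤ using (ℤ; 0ℤ; 1ℤ; -_; _+_; _*_; _-_)
import Data.Integer.Properties as ℤP
open import Data.Integer.Tactic.RingSolver using (solve-∀)
open import Data.Bool using (true; false; if_then_else_)
open import Data.Empty using (⊥; ⊥-elim)
open import Data.Maybe using (Maybe; just; nothing)
open import Data.Product using (_×_; _,_; proj₁; proj₂; ∃)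
open import Data.Product.Properties using (,-injectiveʳ)
open import Data.Sum using (_⊎_; inj₁; inj₂; [_,_]′)
open import Data.List using (List; []; _∷_; [_]; map; concatMap; filter; upTo; applyUpTo; length; _++_; take; drop)
import Data.List.Properties as LP
open import Data.List.Membership.Propositional using (_∈_; find)
import Data.List.Membership.Propositional.Properties as MP
open import Data.List.Membership.Propositional.Properties.WithK using (unique∧set⇒bag)
open import Data.List.Relation.Binary.BagAndSetEquality using (∼bag⇒↭)
open import Data.List.Relation.Binary.Permutation.Propositional as Perm using (_↭_)
open import Data.List.Relation.Unary.All as All using (All; []; _∷_)
import Data.List.Relation.Unary.All.Properties as AllP
open import Data.List.Relation.Unary.AllPairs using ([]; _∷_)
open import Data.List.Relation.Unary.Any as Any using (Any; here; there)
open import Data.List.Relation.Unary.Linked as Linked using (Linked; []; [-]; _∷_; linked?)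
import Data.List.Relation.Unary.Linked.Properties as LinkedP
open import Data.Nat.Induction using (<-rec)
open import Data.List.Relation.Unary.Unique.Propositional using (Unique)
import Data.List.Relation.Unary.Unique.Propositional.Properties as UniqueP
open import Function.Bundles using (mk⇔)
open import Relation.Nullary using (Dec; yes; no; does; ¬_)
open import Relation.Nullary.Decidable using (_×-dec_; ¬?)
open import Relation.Binary.PropositionalEquality hiding ([_])
open import Relation.Binary.Structures using (IsEquivalence)
open import Algebra.Bundles using (CommutativeRing)
import Algebra.Solver.Ring.AlmostCommutativeRing as ACR
import Algebra.Solver.Ring
import Relation.Binary.Reasoning.Setoid as SetoidReasoning

when : {A : Set} {P : A → Set} → ((x : A) → Dec (P x)) → A → ℤ → ℤ
when P? x v = if does (P? x) then v else 0ℤ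

Σ∈-++ : {A : Set} (xs ys : List A) (f : A → ℤ) → Σ∈ (xs ++ ys) f ≡ Σ∈ xs f + Σ∈ ys f
Σ∈-++ []       ys f = sym (ℤP.+-identityˡ _)
Σ∈-++ (x ∷ xs) ys f = trans (cong (f x +_) (Σ∈-++ xs ys f)) (sym (ℤP.+-assoc (f x) _ _))

Σ∈-map : {A B : Set} (h : A → B) (xs : List A) (f : B → ℤ) → Σ∈ (map h xs) f ≡ Σ∈ xs (λ x → f (h x))
Σ∈-map h []       f = refl
Σ∈-map h (x ∷ xs) f = cong (f (h x) +_) (Σ∈-map h xs f)

Σ∈-concatMap : {A B : Set} (g : A → List B) (xs : List A) (f : B → ℤ) →
  Σ∈ (concatMap g xs) f ≡ Σ∈ xs (λ x → Σ∈ (g x) f)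
Σ∈-concatMap g []       f = refl
Σ∈-concatMap g (x ∷ xs) f =
  trans (Σ∈-++ (g x) (concatMap g xs) f) (cong (Σ∈ (g x) f +_) (Σ∈-concatMap g xs f))

Σ∈-applyUpTo : ∀ (h : ℕ → ℕ) m (f : ℕ → ℤ) → Σ∈ (applyUpTo h m) f ≡ Σ∈ (upTo m) (λ k → f (h k))
Σ∈-applyUpTo h zero    f = refl
Σ∈-applyUpTo h (suc m) f =
  cong (f (h 0) +_) (trans (Σ∈-applyUpTo (λ k → h (suc k)) m f) (sym (Σ∈-applyUpTo suc m (λ k → f (h k)))))

Σ∈-cong : {A : Set} (xs : List A) {f g : A → ℤ} → (∀ x → x ∈ xs → f x ≡ g x) → Σ∈ xs f ≡ Σ∈ xs g
Σ∈-cong []       e = refl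
Σ∈-cong (x ∷ xs) e = cong₂ _+_ (e x (here refl)) (Σ∈-cong xs (λ y y∈ → e y (there y∈)))

Σ∈-ext : {A : Set} (xs : List A) {f g : A → ℤ} → (∀ x → f x ≡ g x) → Σ∈ xs f ≡ Σ∈ xs g
Σ∈-ext xs e = Σ∈-cong xs (λ x _ → e x)

Σ∈-+ : {A : Set} (xs : List A) (f g : A → ℤ) → Σ∈ xs (λ x → f x + g x) ≡ Σ∈ xs f + Σ∈ xs g
Σ∈-+ []       f g = refl
Σ∈-+ (x ∷ xs) f g = trans (cong (f x + g x +_) (Σ∈-+ xs f g)) (interchange (f x) (g x) _ _)
  where
  interchange : ∀ a b c d → (a + b) + (c + d) ≡ (a + c) + (b + d)
  interchange = solve-∀

Σ∈-neg : {A : Set} (xs : List A) (f : A → ℤ) → Σ∈ xs (λ x → - f x) ≡ - Σ∈ xs f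
Σ∈-neg []       f = refl
Σ∈-neg (x ∷ xs) f = trans (cong (- f x +_) (Σ∈-neg xs f)) (sym (ℤP.neg-distrib-+ (f x) _))

-- Linearity in the shape needed for expanding (a − b)² = a² + b² − (ab + ab).
Σ∈-linear : {A : Set} (xs : List A) (p r s : A → ℤ) →
  Σ∈ xs (λ x → p x + r x - (s x + s x)) ≡ Σ∈ xs p + Σ∈ xs r - (Σ∈ xs s + Σ∈ xs s)
Σ∈-linear xs p r s = begin
  Σ∈ xs (λ x → p x + r x - (s x + s x))                  ≡⟨ Σ∈-+ xs (λ x → p x + r x) (λ x → - (s x + s x)) ⟩
  Σ∈ xs (λ x → p x + r x) + Σ∈ xs (λ x → - (s x + s x))   ≡⟨ cong₂ _+_ (Σ∈-+ xs p r) (trans (Σ∈-neg xs _) (cong -_ (Σ∈-+ xs s s))) ⟩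
  Σ∈ xs p + Σ∈ xs r - (Σ∈ xs s + Σ∈ xs s)                 ∎
  where open ≡-Reasoning

Σ∈-*ˡ : {A : Set} (xs : List A) (c : ℤ) (f : A → ℤ) → Σ∈ xs (λ x → c * f x) ≡ c * Σ∈ xs f
Σ∈-*ˡ []       c f = sym (ℤP.*-zeroʳ c)
Σ∈-*ˡ (x ∷ xs) c f = trans (cong (c * f x +_) (Σ∈-*ˡ xs c f)) (sym (ℤP.*-distribˡ-+ c (f x) _))

Σ∈-*ʳ : {A : Set} (xs : List A) (c : ℤ) (f : A → ℤ) → Σ∈ xs (λ x → f x * c) ≡ Σ∈ xs f * c
Σ∈-*ʳ xs c f = trans (Σ∈-ext xs (λ x → ℤP.*-comm (f x) c)) (trans (Σ∈-*ˡ xs c f) (ℤP.*-comm c _))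

Σ∈-zero : {A : Set} (xs : List A) → Σ∈ xs (λ _ → 0ℤ) ≡ 0ℤ
Σ∈-zero []       = refl
Σ∈-zero (x ∷ xs) = trans (ℤP.+-identityˡ _) (Σ∈-zero xs)

Σ∈-swap : {A B : Set} (xs : List A) (ys : List B) (f : A → B → ℤ) →
  Σ∈ xs (λ x → Σ∈ ys (f x)) ≡ Σ∈ ys (λ y → Σ∈ xs (λ x → f x y))
Σ∈-swap []       ys f = sym (Σ∈-zero ys)
Σ∈-swap (x ∷ xs) ys f = trans (cong (Σ∈ ys (f x) +_) (Σ∈-swap xs ys f)) (sym (Σ∈-+ ys (f x) _))

Σ∈-nonneg : {A : Set} (xs : List A) (f : A → ℤ) → (∀ x → x ∈ xs → 0ℤ ℤ.≤ f x) → 0ℤ ℤ.≤ Σ∈ xs f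
Σ∈-nonneg []       f h = ℤP.≤-refl
Σ∈-nonneg (x ∷ xs) f h = ℤP.+-mono-≤ (h x (here refl)) (Σ∈-nonneg xs f (λ y y∈ → h y (there y∈)))

Σ∈-mono : {A : Set} (xs : List A) (f g : A → ℤ) → (∀ x → x ∈ xs → f x ℤ.≤ g x) → Σ∈ xs f ℤ.≤ Σ∈ xs g
Σ∈-mono []       f g h = ℤP.≤-refl
Σ∈-mono (x ∷ xs) f g h = ℤP.+-mono-≤ (h x (here refl)) (Σ∈-mono xs f g (λ y y∈ → h y (there y∈)))

Σ∈-empty : {A : Set} (xs : List A) (f : A → ℤ) → (∀ x → x ∈ xs → ⊥) → Σ∈ xs f ≡ 0ℤ
Σ∈-empty []       f e = refl
Σ∈-empty (x ∷ xs) f e = ⊥-elim (e x (here refl))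

Σ∈-filter : {A : Set} {P : A → Set} (P? : (x : A) → Dec (P x)) (xs : List A) (f : A → ℤ) →
  Σ∈ (filter P? xs) f ≡ Σ∈ xs (λ x → when P? x (f x))
Σ∈-filter P? []       f = refl
Σ∈-filter P? (x ∷ xs) f with does (P? x)
... | true  = cong (f x +_) (Σ∈-filter P? xs f)
... | false = trans (Σ∈-filter P? xs f) (sym (ℤP.+-identityˡ _))

Σ∈-split : {A : Set} {R : A → Set} (R? : ∀ x → Dec (R x)) (xs : List A) (f : A → ℤ) →
  Σ∈ xs f ≡ Σ∈ (filter (λ x → ¬? (R? x)) xs) f + Σ∈ (filter R? xs) f
Σ∈-split R? xs f =
  trans (Σ∈-ext xs pointwise) (trans (Σ∈-+ xs _ _) (sym (cong₂ _+_ (Σ∈-filter _ xs f) (Σ∈-filter R? xs f))))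
  where
  pointwise : ∀ x → f x ≡ when (λ x → ¬? (R? x)) x (f x) + when R? x (f x)
  pointwise x with R? x
  ... | yes _ = sym (ℤP.+-identityˡ _)
  ... | no _  = sym (ℤP.+-identityʳ _)

Σ∈-filter-equiv : {A : Set} {P Q : A → Set} (xs : List A) (P? : ∀ x → Dec (P x)) (Q? : ∀ x → Dec (Q x))
  (f : A → ℤ) → (∀ x → x ∈ xs → (P x → Q x) × (Q x → P x)) → Σ∈ (filter P? xs) f ≡ Σ∈ (filter Q? xs) f
Σ∈-filter-equiv xs P? Q? f e = trans (Σ∈-filter P? xs f) (trans (Σ∈-cong xs pointwise) (sym (Σ∈-filter Q? xs f)))
  where
  pointwise : ∀ x → x ∈ xs → when P? x (f x) ≡ when Q? x (f x)
  pointwise x x∈ with P? x | Q? x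
  ... | yes _ | yes _ = refl
  ... | no _  | no _  = refl
  ... | yes p | no q  = ⊥-elim (q (proj₁ (e x x∈) p))
  ... | no p  | yes q = ⊥-elim (p (proj₂ (e x x∈) q))

Σ∈-filter-split : {A : Set} {P Q R : A → Set} (xs : List A)
  (P? : ∀ x → Dec (P x)) (Q? : ∀ x → Dec (Q x)) (R? : ∀ x → Dec (R x)) (f : A → ℤ) →
  (∀ x → x ∈ xs → P x → Q x ⊎ R x) → (∀ x → x ∈ xs → Q x → P x) → (∀ x → x ∈ xs → R x → P x) →
  (∀ x → x ∈ xs → Q x → R x → ⊥) →
  Σ∈ (filter P? xs) f ≡ Σ∈ (filter Q? xs) f + Σ∈ (filter R? xs) f
Σ∈-filter-split xs P? Q? R? f cover Q⇒P R⇒P disjoint =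
  trans (Σ∈-filter P? xs f) (trans (Σ∈-cong xs pointwise)
    (trans (Σ∈-+ xs _ _) (sym (cong₂ _+_ (Σ∈-filter Q? xs f) (Σ∈-filter R? xs f)))))
  where
  pointwise : ∀ x → x ∈ xs → when P? x (f x) ≡ when Q? x (f x) + when R? x (f x)
  pointwise x x∈ with P? x | Q? x | R? x
  ... | yes p | yes q | yes r = ⊥-elim (disjoint x x∈ q r)
  ... | yes p | yes q | no r  = sym (ℤP.+-identityʳ _)
  ... | yes p | no q  | yes r = sym (ℤP.+-identityˡ _)
  ... | yes p | no q  | no r  = [ (λ q′ → ⊥-elim (q q′)) , (λ r′ → ⊥-elim (r r′)) ]′ (cover x x∈ p)
  ... | no p  | yes q | _     = ⊥-elim (p (Q⇒P x x∈ q))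
  ... | no p  | no q  | yes r = ⊥-elim (p (R⇒P x x∈ r))
  ... | no p  | no q  | no r  = refl

Σ∈-filter-× : {A : Set} {P Q : A → Set} (P? : ∀ x → Dec (P x)) (Q? : ∀ x → Dec (Q x)) (xs : List A) (f : A → ℤ) →
  Σ∈ (filter (λ x → P? x ×-dec Q? x) xs) f ≡ Σ∈ (filter Q? (filter P? xs)) f
Σ∈-filter-× P? Q? xs f =
  trans (Σ∈-filter _ xs f) (trans (Σ∈-ext xs pointwise) (sym (trans (Σ∈-filter Q? (filter P? xs) f) (Σ∈-filter P? xs _))))
  where
  pointwise : ∀ x → when (λ x → P? x ×-dec Q? x) x (f x) ≡ when P? x (when Q? x (f x))
  pointwise x with P? x | Q? x
  ... | yes _ | yes _ = refl
  ... | yes _ | no _  = refl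
  ... | no _  | yes _ = refl
  ... | no _  | no _  = refl

Σ∈-↭ : {A : Set} {xs ys : List A} (f : A → ℤ) → xs ↭ ys → Σ∈ xs f ≡ Σ∈ ys f
Σ∈-↭ f Perm.refl           = refl
Σ∈-↭ f (Perm.prep x p)     = cong (f x +_) (Σ∈-↭ f p)
Σ∈-↭ f (Perm.swap x y p)   = trans (sym (ℤP.+-assoc (f x) (f y) _))
  (trans (cong₂ _+_ (ℤP.+-comm (f x) (f y)) (Σ∈-↭ f p)) (ℤP.+-assoc (f y) (f x) _))
Σ∈-↭ f (Perm.trans p q)    = trans (Σ∈-↭ f p) (Σ∈-↭ f q)

unique-map : {A B : Set} (h : A → B) (xs : List A) → Unique xs →
  (∀ x y → x ∈ xs → y ∈ xs → h x ≡ h y → x ≡ y) → Unique (map h xs)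
unique-map h []       u       inj = []
unique-map h (x ∷ xs) (a ∷ u) inj =
  fresh xs a (λ y y∈ e → inj x y (here refl) (there y∈) e)
  ∷ unique-map h xs u (λ y z y∈ z∈ → inj y z (there y∈) (there z∈))
  where
  fresh : (ys : List _) → All (λ y → ¬ x ≡ y) ys → (∀ y → y ∈ ys → h x ≡ h y → x ≡ y) →
          All (λ z → ¬ h x ≡ z) (map h ys)
  fresh []       _        _ = []
  fresh (y ∷ ys) (n ∷ ns) f = (λ e → n (f y (here refl) e)) ∷ fresh ys ns (λ z z∈ → f z (there z∈))

Σ∈-bijection : {A B : Set} (xs : List A) (ys : List B) → Unique xs → Unique ys → (h : A → B) →
  (∀ x → x ∈ xs → h x ∈ ys) →
  (∀ y → y ∈ ys → ∃ λ x → x ∈ xs × h x ≡ y) →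
  (∀ x y → x ∈ xs → y ∈ xs → h x ≡ h y → x ≡ y) →
  (f : B → ℤ) → Σ∈ ys f ≡ Σ∈ xs (λ x → f (h x))
Σ∈-bijection xs ys ux uy h into onto inj f =
  trans (Σ∈-↭ f (∼bag⇒↭ (unique∧set⇒bag uy (unique-map h xs ux inj) (mk⇔ to from)))) (Σ∈-map h xs f)
  where
  to : ∀ {y} → y ∈ ys → y ∈ map h xs
  to {y} y∈ with onto y y∈
  ... | x , x∈ , refl = MP.∈-map⁺ h x∈
  from : ∀ {y} → y ∈ map h xs → y ∈ ys
  from y∈ with MP.∈-map⁻ h y∈
  ... | x , x∈ , refl = into x x∈

unique-concatMap : {A B : Set} (g : A → List B) (tag : B → A) (xs : List A) → Unique xs →
  (∀ x → Unique (g x)) → (∀ x y → y ∈ g x → tag y ≡ x) → Unique (concatMap g xs)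
unique-concatMap g tag []       u       ug tagged = []
unique-concatMap g tag (x ∷ xs) (a ∷ u) ug tagged =
  UniqueP.++⁺ (ug x) (unique-concatMap g tag xs u ug tagged) disjoint
  where
  disjoint : ∀ {y} → y ∈ g x × y ∈ concatMap g xs → ⊥
  disjoint (y∈ , y∈′) = go xs a (MP.∈-concatMap⁻ g {xs = xs} y∈′)
    where
    go : (zs : List _) → All (λ z → ¬ x ≡ z) zs → Any (λ z → _ ∈ g z) zs → ⊥
    go (z ∷ zs) (n ∷ ns) (here p)  = n (trans (sym (tagged x _ y∈)) (tagged z _ p))
    go (z ∷ zs) (n ∷ ns) (there p) = go zs ns p

unique-candidates : ∀ l b → Unique (candidates l b)
unique-candidates zero    b = [] ∷ []
unique-candidates (suc l) b =
  All.tabulate nonempty ∷ unique-concatMap extend largest (upTo (suc b)) (UniqueP.upTo⁺ (suc b))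
    (λ x → UniqueP.map⁺ LP.∷-injectiveʳ (unique-candidates l b)) headed
  where
  extend : ℕ → List (List ℕ)
  extend x = map (x ∷_) (candidates l b)
  headed : ∀ x y → y ∈ extend x → largest y ≡ x
  headed x y y∈ with MP.∈-map⁻ (x ∷_) y∈
  ... | _ , _ , refl = refl
  nonempty : ∀ {y} → y ∈ concatMap extend (upTo (suc b)) → ¬ [] ≡ y
  nonempty y∈ refl with Any.satisfied (MP.∈-concatMap⁻ extend {xs = upTo (suc b)} y∈)
  ... | x , p with MP.∈-map⁻ (x ∷_) p
  ... | _ , _ , ()

candidates⁺ : ∀ l b (xs : List ℕ) → length xs ≤ l → All (_≤ b) xs → xs ∈ candidates l b
candidates⁺ zero    b []       _        _          = here refl
candidates⁺ (suc l) b []       _        _          = here refl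
candidates⁺ (suc l) b (x ∷ xs) (s≤s le) (x≤ ∷ xs≤) =
  there (MP.∈-concatMap⁺ (λ y → map (y ∷_) (candidates l b)) {xs = upTo (suc b)}
    (Any.map (λ { refl → MP.∈-map⁺ (x ∷_) (candidates⁺ l b xs le xs≤) }) (MP.∈-upTo⁺ (s≤s x≤))))

length≤sum : (xs : List ℕ) → All (0 ℕ.<_) xs → length xs ≤ sum xs
length≤sum []       _        = z≤n
length≤sum (x ∷ xs) (p ∷ ps) = ℕP.+-mono-≤ p (length≤sum xs ps)

entries≤sum : (xs : List ℕ) → All (_≤ sum xs) xs
entries≤sum []       = []
entries≤sum (x ∷ xs) =
  ℕP.m≤m+n x (sum xs) ∷ All.map (λ le → ℕP.≤-trans le (ℕP.m≤n+m (sum xs) x)) (entries≤sum xs)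

largest≤sum : ∀ xs → largest xs ≤ sum xs
largest≤sum []       = z≤n
largest≤sum (x ∷ xs) = ℕP.m≤m+n x (sum xs)

partitions⁺ : ∀ n λ′ → IsPartitionOf n λ′ → λ′ ∈ partitions n
partitions⁺ n λ′ p@(_ , pos , refl) =
  MP.∈-filter⁺ (isPartitionOf? n) (candidates⁺ n n λ′ (length≤sum λ′ pos) (entries≤sum λ′)) p

partitions⁻ : ∀ n λ′ → λ′ ∈ partitions n → IsPartitionOf n λ′
partitions⁻ n λ′ p = proj₂ (MP.∈-filter⁻ (isPartitionOf? n) {xs = candidates n n} p)

unique-partitions : ∀ n → Unique (partitions n)
unique-partitions n = UniqueP.filter⁺ (isPartitionOf? n) (unique-candidates n n)

∈-filter-partitions⁻ : ∀ {R : List ℕ → Set} (R? : ∀ x → Dec (R x)) m x →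
  x ∈ filter R? (partitions m) → IsPartitionOf m x × R x
∈-filter-partitions⁻ R? m x x∈ with MP.∈-filter⁻ R? {xs = partitions m} x∈
... | x∈′ , r = partitions⁻ m x x∈′ , r

∈-filter-partitions⁺ : ∀ {R : List ℕ → Set} (R? : ∀ x → Dec (R x)) m x →
  IsPartitionOf m x → R x → x ∈ filter R? (partitions m)
∈-filter-partitions⁺ R? m x p r = MP.∈-filter⁺ R? (partitions⁺ m x p) r

Σ∈-partition-bijection : {P Q : List ℕ → Set} (n n′ : ℕ) (P? : ∀ x → Dec (P x)) (Q? : ∀ x → Dec (Q x))
  (h : List ℕ → List ℕ) →
  (∀ x → IsPartitionOf n′ x → Q x → IsPartitionOf n (h x) × P (h x)) →
  (∀ y → IsPartitionOf n y → P y → ∃ λ x → IsPartitionOf n′ x × Q x × h x ≡ y) →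
  (∀ x y → IsPartitionOf n′ x → IsPartitionOf n′ y → h x ≡ h y → x ≡ y) →
  (f : List ℕ → ℤ) → Σ∈ (filter P? (partitions n)) f ≡ Σ∈ (filter Q? (partitions n′)) (λ x → f (h x))
Σ∈-partition-bijection n n′ P? Q? h into onto inj f =
  Σ∈-bijection (filter Q? (partitions n′)) (filter P? (partitions n))
    (UniqueP.filter⁺ Q? (unique-partitions n′)) (UniqueP.filter⁺ P? (unique-partitions n)) h into′ onto′ inj′ f
  where
  into′ : ∀ x → x ∈ filter Q? (partitions n′) → h x ∈ filter P? (partitions n)
  into′ x x∈ with ∈-filter-partitions⁻ Q? n′ x x∈
  ... | p , q with into x p q
  ... | p′ , r = ∈-filter-partitions⁺ P? n (h x) p′ r
  onto′ : ∀ y → y ∈ filter P? (partitions n) → ∃ λ x → x ∈ filter Q? (partitions n′) × h x ≡ y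
  onto′ y y∈ with ∈-filter-partitions⁻ P? n y y∈
  ... | p , r with onto y p r
  ... | x , px , qx , e = x , ∈-filter-partitions⁺ Q? n′ x px qx , e
  inj′ : ∀ x y → x ∈ filter Q? (partitions n′) → y ∈ filter Q? (partitions n′) → h x ≡ h y → x ≡ y
  inj′ x y x∈ y∈ = inj x y (proj₁ (∈-filter-partitions⁻ Q? n′ x x∈)) (proj₁ (∈-filter-partitions⁻ Q? n′ y y∈))

linked-head : ∀ {x xs} → Linked _≥_ (x ∷ xs) → All (_≤ x) xs
linked-head [-]      = []
linked-head (le ∷ l) = le ∷ All.map (λ le′ → ℕP.≤-trans le′ le) (linked-head l)

linked>-head : ∀ {x xs} → Linked _>_ (x ∷ xs) → All (ℕ._< x) xs
linked>-head [-]      = []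
linked>-head (le ∷ l) = le ∷ All.map (λ le′ → ℕP.<-trans le′ le) (linked>-head l)

Ser : Set
Ser = ℕ → ℤ

infix 4 _≈_
_≈_ : Ser → Ser → Set
f ≈ g = ∀ n → f n ≡ g n

infixl 6 _⊕_ _⊖_
infixl 7 _⊛_

_⊕_ : Ser → Ser → Ser
(f ⊕ g) n = f n + g n

⊝ : Ser → Ser
⊝ f n = - f n

_⊖_ : Ser → Ser → Ser
f ⊖ g = f ⊕ ⊝ g

𝟘 : Ser
𝟘 _ = 0ℤ

δ : Ser
δ zero    = 1ℤ
δ (suc _) = 0ℤ

tl : Ser → Ser
tl f k = f (suc k)

scale : ℤ → Ser → Ser
scale c f k = c * f k

const : ℤ → Ser
const c = scale c δ

_⊛_ : Ser → Ser → Ser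
(f ⊛ g) zero    = f 0 * g 0
(f ⊛ g) (suc n) = f 0 * g (suc n) + (tl f ⊛ g) n

⊛-congˡ : ∀ f f′ g → f ≈ f′ → f ⊛ g ≈ f′ ⊛ g
⊛-congˡ f f′ g e zero    = cong (_* g 0) (e 0)
⊛-congˡ f f′ g e (suc n) = cong₂ _+_ (cong (_* g (suc n)) (e 0)) (⊛-congˡ (tl f) (tl f′) g (λ k → e (suc k)) n)

⊛-congʳ : ∀ f g g′ → g ≈ g′ → f ⊛ g ≈ f ⊛ g′
⊛-congʳ f g g′ e zero    = cong (f 0 *_) (e 0)
⊛-congʳ f g g′ e (suc n) = cong₂ _+_ (cong (f 0 *_) (e (suc n))) (⊛-congʳ (tl f) g g′ e n)

⊛-scale : ∀ c f g → scale c f ⊛ g ≈ scale c (f ⊛ g)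
⊛-scale c f g zero    = ℤP.*-assoc c (f 0) (g 0)
⊛-scale c f g (suc n) = begin
  c * f 0 * g (suc n) + (tl (scale c f) ⊛ g) n   ≡⟨ cong₂ _+_ (ℤP.*-assoc c (f 0) _) (⊛-scale c (tl f) g n) ⟩
  c * (f 0 * g (suc n)) + c * (tl f ⊛ g) n       ≡⟨ sym (ℤP.*-distribˡ-+ c _ _) ⟩
  c * (f 0 * g (suc n) + (tl f ⊛ g) n)           ∎
  where open ≡-Reasoning

⊛-distribʳ : ∀ f g h → (f ⊕ g) ⊛ h ≈ f ⊛ h ⊕ g ⊛ h
⊛-distribʳ f g h zero    = ℤP.*-distribʳ-+ (h 0) (f 0) (g 0)
⊛-distribʳ f g h (suc n) =
  trans (cong₂ _+_ (ℤP.*-distribʳ-+ (h (suc n)) (f 0) (g 0)) (⊛-distribʳ (tl f) (tl g) h n))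
        (interchange (f 0 * h (suc n)) (g 0 * h (suc n)) ((tl f ⊛ h) n) ((tl g ⊛ h) n))
  where
  interchange : ∀ a b c d → (a + b) + (c + d) ≡ (a + c) + (b + d)
  interchange = solve-∀

⊛-distribˡ : ∀ f g h → f ⊛ (g ⊕ h) ≈ f ⊛ g ⊕ f ⊛ h
⊛-distribˡ f g h zero    = ℤP.*-distribˡ-+ (f 0) (g 0) (h 0)
⊛-distribˡ f g h (suc n) =
  trans (cong₂ _+_ (ℤP.*-distribˡ-+ (f 0) _ _) (⊛-distribˡ (tl f) g h n))
        (interchange (f 0 * g (suc n)) (f 0 * h (suc n)) ((tl f ⊛ g) n) ((tl f ⊛ h) n))
  where
  interchange : ∀ a b c d → (a + b) + (c + d) ≡ (a + c) + (b + d)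
  interchange = solve-∀

⊛-zeroˡ : ∀ f g → f ≈ 𝟘 → f ⊛ g ≈ 𝟘
⊛-zeroˡ f g e zero    = trans (cong (_* g 0) (e 0)) (ℤP.*-zeroˡ (g 0))
⊛-zeroˡ f g e (suc n) =
  cong₂ _+_ (trans (cong (_* g (suc n)) (e 0)) (ℤP.*-zeroˡ (g (suc n)))) (⊛-zeroˡ (tl f) g (λ k → e (suc k)) n)

⊛-identityˡ : ∀ f → δ ⊛ f ≈ f
⊛-identityˡ f zero    = ℤP.*-identityˡ (f 0)
⊛-identityˡ f (suc n) =
  trans (cong₂ _+_ (ℤP.*-identityˡ (f (suc n))) (⊛-zeroˡ (tl δ) f (λ _ → refl) n)) (ℤP.+-identityʳ _)

⊛-suc-right : ∀ f g n → (f ⊛ g) (suc n) ≡ (f ⊛ tl g) n + f (suc n) * g 0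
⊛-suc-right f g zero    = refl
⊛-suc-right f g (suc n) =
  trans (cong (f 0 * g (suc (suc n)) +_) (⊛-suc-right (tl f) g n))
        (sym (ℤP.+-assoc (f 0 * g (suc (suc n))) ((tl f ⊛ tl g) n) (f (suc (suc n)) * g 0)))

⊛-comm : ∀ f g → f ⊛ g ≈ g ⊛ f
⊛-comm f g zero    = ℤP.*-comm (f 0) (g 0)
⊛-comm f g (suc n) = begin
  f 0 * g (suc n) + (tl f ⊛ g) n    ≡⟨ cong₂ _+_ (ℤP.*-comm (f 0) _) (⊛-comm (tl f) g n) ⟩
  g (suc n) * f 0 + (g ⊛ tl f) n    ≡⟨ ℤP.+-comm (g (suc n) * f 0) _ ⟩
  (g ⊛ tl f) n + g (suc n) * f 0    ≡⟨ sym (⊛-suc-right g f n) ⟩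
  (g ⊛ f) (suc n)                   ∎
  where open ≡-Reasoning

⊛-assoc : ∀ f g h → (f ⊛ g) ⊛ h ≈ f ⊛ (g ⊛ h)
⊛-assoc f g h zero    = ℤP.*-assoc (f 0) (g 0) (h 0)
⊛-assoc f g h (suc n) = begin
  f 0 * g 0 * h (suc n) + (tl (f ⊛ g) ⊛ h) n
    ≡⟨ cong (f 0 * g 0 * h (suc n) +_) (⊛-distribʳ (scale (f 0) (tl g)) (tl f ⊛ g) h n) ⟩
  f 0 * g 0 * h (suc n) + ((scale (f 0) (tl g) ⊛ h) n + ((tl f ⊛ g) ⊛ h) n)
    ≡⟨ cong (f 0 * g 0 * h (suc n) +_) (cong₂ _+_ (⊛-scale (f 0) (tl g) h n) (⊛-assoc (tl f) g h n)) ⟩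
  f 0 * g 0 * h (suc n) + (f 0 * (tl g ⊛ h) n + (tl f ⊛ (g ⊛ h)) n)
    ≡⟨ regroup (f 0) (g 0) (h (suc n)) _ _ ⟩
  f 0 * (g 0 * h (suc n) + (tl g ⊛ h) n) + (tl f ⊛ (g ⊛ h)) n ∎
  where
  open ≡-Reasoning
  regroup : ∀ a b c d e → a * b * c + (a * d + e) ≡ a * (b * c + d) + e
  regroup = solve-∀

⊛-as-Σ : ∀ f g n → (f ⊛ g) n ≡ Σ≤ n (λ k → f k * g (n ∸ k))
⊛-as-Σ f g zero    = sym (ℤP.+-identityʳ _)
⊛-as-Σ f g (suc n) =
  cong (f 0 * g (suc n) +_)
    (trans (⊛-as-Σ (tl f) g n) (sym (Σ∈-applyUpTo suc (suc n) (λ k → f k * g (suc n ∸ k)))))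

-- The ring ℤ[[q]] and its ring solver.  Equality of series is wrapped in a
-- record so that Agda can recover the two series from an equation's type.

infix 4 _≋_
record _≋_ (f g : Ser) : Set where
  constructor mk≋
  field at : f ≈ g
open _≋_ public

≋-refl : ∀ {f} → f ≋ f
≋-refl = mk≋ (λ _ → refl)

≋-sym : ∀ {f g} → f ≋ g → g ≋ f
≋-sym e = mk≋ (λ n → sym (at e n))

≋-trans : ∀ {f g h} → f ≋ g → g ≋ h → f ≋ h
≋-trans e e′ = mk≋ (λ n → trans (at e n) (at e′ n))

⊕-cong : ∀ {f f′ g g′} → f ≋ f′ → g ≋ g′ → f ⊕ g ≋ f′ ⊕ g′
⊕-cong e e′ = mk≋ (λ n → cong₂ _+_ (at e n) (at e′ n))

⊝-cong : ∀ {f f′} → f ≋ f′ → ⊝ f ≋ ⊝ f′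
⊝-cong e = mk≋ (λ n → cong -_ (at e n))

⊖-cong : ∀ {f f′ g g′} → f ≋ f′ → g ≋ g′ → f ⊖ g ≋ f′ ⊖ g′
⊖-cong e e′ = ⊕-cong e (⊝-cong e′)

⊛-cong : ∀ {f f′ g g′} → f ≋ f′ → g ≋ g′ → f ⊛ g ≋ f′ ⊛ g′
⊛-cong {f} {f′} {g} {g′} e e′ = mk≋ (λ n → trans (⊛-congˡ f f′ g (at e) n) (⊛-congʳ f′ g g′ (at e′) n))

-- Congruence in one argument, the other being kept fixed (named, since Agda
-- cannot infer the fixed argument from a sum or product of series).
⊛-congˡ≋ : ∀ {f f′} g → f ≋ f′ → f ⊛ g ≋ f′ ⊛ g
⊛-congˡ≋ g e = ⊛-cong e (≋-refl {g})

⊛-congʳ≋ : ∀ f {g g′} → g ≋ g′ → f ⊛ g ≋ f ⊛ g′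
⊛-congʳ≋ f e = ⊛-cong (≋-refl {f}) e

⊕-congˡ≋ : ∀ {f f′} g → f ≋ f′ → f ⊕ g ≋ f′ ⊕ g
⊕-congˡ≋ g e = ⊕-cong e (≋-refl {g})

⊕-congʳ≋ : ∀ f {g g′} → g ≋ g′ → f ⊕ g ≋ f ⊕ g′
⊕-congʳ≋ f e = ⊕-cong (≋-refl {f}) e

⊖-congˡ≋ : ∀ {f f′} g → f ≋ f′ → f ⊖ g ≋ f′ ⊖ g
⊖-congˡ≋ g e = ⊖-cong e (≋-refl {g})

seriesRing : CommutativeRing _ _
seriesRing = record
  { Carrier = Ser ; _≈_ = _≋_ ; _+_ = _⊕_ ; _*_ = _⊛_ ; -_ = ⊝ ; 0# = 𝟘 ; 1# = δ
  ; isCommutativeRing = record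
    { isRing = record
      { +-isAbelianGroup = record
        { isGroup = record
          { isMonoid = record
            { isSemigroup = record
              { isMagma = record { isEquivalence = ≋-isEquivalence ; ∙-cong = ⊕-cong }
              ; assoc = λ f g h → mk≋ (λ n → ℤP.+-assoc (f n) (g n) (h n)) }
            ; identity = (λ f → mk≋ (λ n → ℤP.+-identityˡ (f n))) , (λ f → mk≋ (λ n → ℤP.+-identityʳ (f n))) }
          ; inverse = (λ f → mk≋ (λ n → ℤP.+-inverseˡ (f n))) , (λ f → mk≋ (λ n → ℤP.+-inverseʳ (f n)))
          ; ⁻¹-cong = ⊝-cong }
        ; comm = λ f g → mk≋ (λ n → ℤP.+-comm (f n) (g n)) }
      ; *-cong = ⊛-cong
      ; *-assoc = λ f g h → mk≋ (⊛-assoc f g h)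
      ; *-identity = (λ f → mk≋ (⊛-identityˡ f)) , (λ f → mk≋ (λ n → trans (⊛-comm f δ n) (⊛-identityˡ f n)))
      ; distrib = (λ f g h → mk≋ (⊛-distribˡ f g h)) , (λ f g h → mk≋ (⊛-distribʳ g h f)) }
    ; *-comm = λ f g → mk≋ (⊛-comm f g) } }
  where
  ≋-isEquivalence : IsEquivalence _≋_
  ≋-isEquivalence = record { refl = ≋-refl ; sym = ≋-sym ; trans = ≋-trans }

-- The constants  c ↦ const c  form a ring morphism ℤ → ℤ[[q]], which lets the
-- ring solver normalise polynomial identities in series with integer coefficients.
constMorphism : CommutativeRing.rawRing ℤP.+-*-commutativeRing ACR.-Raw-AlmostCommutative⟶
                ACR.fromCommutativeRing seriesRing
constMorphism = record
  { ⟦_⟧    = const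
  ; +-homo = λ c d → mk≋ (λ n → ℤP.*-distribʳ-+ (δ n) c d)
  ; *-homo = λ c d → mk≋ (λ n → trans (ℤP.*-assoc c d (δ n))
                         (sym (trans (⊛-scale c δ (const d) n) (cong (c *_) (⊛-identityˡ (const d) n)))))
  ; -‿homo = λ c → mk≋ (λ n → sym (ℤP.neg-distribˡ-* c (δ n)))
  ; 0-homo = mk≋ (λ n → ℤP.*-zeroˡ (δ n))
  ; 1-homo = mk≋ (λ n → ℤP.*-identityˡ (δ n)) }

const≟ : ∀ a b → Maybe (const a ≋ const b)
const≟ a b with a ℤP.≟ b
... | yes refl = just ≋-refl
... | no _     = nothing

open Algebra.Solver.Ring (CommutativeRing.rawRing ℤP.+-*-commutativeRing) (ACR.fromCommutativeRing seriesRing)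
  constMorphism const≟ using (solve; _:+_; _:*_; _:-_; _:=_; con)

module ≋-Reasoning = SetoidReasoning (CommutativeRing.setoid seriesRing)

const-one : const 1ℤ ≋ δ
const-one = mk≋ (λ n → ℤP.*-identityˡ (δ n))

const-zero : const 0ℤ ≋ 𝟘
const-zero = mk≋ (λ n → ℤP.*-zeroˡ (δ n))

sh : ℕ → Ser → Ser
sh k f n with k ℕP.≤? n
... | yes _ = f (n ∸ k)
... | no _  = 0ℤ

sh-yes : ∀ k f n → k ≤ n → sh k f n ≡ f (n ∸ k)
sh-yes k f n le with k ℕP.≤? n
... | yes _   = refl
... | no nle  = ⊥-elim (nle le)

sh-no : ∀ k f n → ¬ k ≤ n → sh k f n ≡ 0ℤ
sh-no k f n nle with k ℕP.≤? n
... | yes le = ⊥-elim (nle le)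
... | no _   = refl

sh-cong : ∀ k {f g} → f ≈ g → sh k f ≈ sh k g
sh-cong k e n with k ℕP.≤? n
... | yes _ = e (n ∸ k)
... | no _  = refl

sh-zero : ∀ f → sh 0 f ≈ f
sh-zero f n = sh-yes 0 f n z≤n

sh-suc-tl : ∀ k f m → sh (suc k) f (suc m) ≡ sh k f m
sh-suc-tl k f m with k ℕP.≤? m
... | yes le  = sh-yes (suc k) f (suc m) (s≤s le)
... | no nle  = sh-no (suc k) f (suc m) (λ p → nle (ℕP.≤-pred p))

sh-suc-at0 : ∀ k f → sh (suc k) f 0 ≡ 0ℤ
sh-suc-at0 k f = sh-no (suc k) f 0 (λ ())

⊛-sh : ∀ k g f → sh k g ⊛ f ≈ sh k (g ⊛ f)
⊛-sh zero    g f n       = trans (⊛-congˡ (sh 0 g) g f (sh-zero g) n) (sym (sh-zero (g ⊛ f) n))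
⊛-sh (suc k) g f zero    = trans (cong (_* f 0) (sh-suc-at0 k g)) (sym (sh-suc-at0 k (g ⊛ f)))
⊛-sh (suc k) g f (suc n) = begin
  sh (suc k) g 0 * f (suc n) + (tl (sh (suc k) g) ⊛ f) n
    ≡⟨ cong₂ _+_ (cong (_* f (suc n)) (sh-suc-at0 k g)) (⊛-congˡ _ (sh k g) f (sh-suc-tl k g) n) ⟩
  0ℤ + (sh k g ⊛ f) n           ≡⟨ ℤP.+-identityˡ _ ⟩
  (sh k g ⊛ f) n                ≡⟨ ⊛-sh k g f n ⟩
  sh k (g ⊛ f) n                ≡⟨ sym (sh-suc-tl k (g ⊛ f) n) ⟩
  sh (suc k) (g ⊛ f) (suc n)    ∎
  where open ≡-Reasoning

sh-sh : ∀ a b f → sh a (sh b f) ≈ sh (a ℕ.+ b) f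
sh-sh zero    b f n       = sh-zero (sh b f) n
sh-sh (suc a) b f zero    = trans (sh-suc-at0 a (sh b f)) (sym (sh-suc-at0 (a ℕ.+ b) f))
sh-sh (suc a) b f (suc n) = trans (sh-suc-tl a (sh b f) n) (trans (sh-sh a b f n) (sym (sh-suc-tl (a ℕ.+ b) f n)))

X : ℕ → Ser
X k = sh k δ

sh≈X⊛ : ∀ k f → sh k f ≈ X k ⊛ f
sh≈X⊛ k f n = sym (trans (⊛-sh k δ f n) (sh-cong k (⊛-identityˡ f) n))

X-cong : ∀ {a b} → a ≡ b → X a ≋ X b
X-cong refl = ≋-refl

X-+ : ∀ a b → X a ⊛ X b ≋ X (a ℕ.+ b)
X-+ a b = mk≋ (λ n → trans (sym (sh≈X⊛ a (X b) n)) (sh-sh a b δ n))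

X-zero : X 0 ≋ δ
X-zero = mk≋ (sh-zero δ)

oneMinusX : ℕ → Ser
oneMinusX k = δ ⊖ X k

-- 1 − q^k in the form the ring solver handles.
oneMinusX≋ : ∀ k → oneMinusX k ≋ const 1ℤ ⊖ X k
oneMinusX≋ k = ⊖-cong (≋-sym const-one) ≋-refl

Nonneg : Ser → Set
Nonneg f = ∀ n → 0ℤ ℤ.≤ f n

nonneg-* : ∀ {a b} → 0ℤ ℤ.≤ a → 0ℤ ℤ.≤ b → 0ℤ ℤ.≤ a * b
nonneg-* {ℤ.+ m} {ℤ.+ k} _ _ = subst (0ℤ ℤ.≤_) (ℤP.pos-* m k) (ℤ.+≤+ z≤n)

Nonneg-⊕ : ∀ {f g} → Nonneg f → Nonneg g → Nonneg (f ⊕ g)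
Nonneg-⊕ a b n = ℤP.+-mono-≤ (a n) (b n)

Nonneg-⊛ : ∀ f g → Nonneg f → Nonneg g → Nonneg (f ⊛ g)
Nonneg-⊛ f g a b zero    = nonneg-* (a 0) (b 0)
Nonneg-⊛ f g a b (suc n) = ℤP.+-mono-≤ (nonneg-* (a 0) (b (suc n))) (Nonneg-⊛ (tl f) g (λ k → a (suc k)) b n)

Nonneg-sh : ∀ k f → Nonneg f → Nonneg (sh k f)
Nonneg-sh k f a n with k ℕP.≤? n
... | yes _ = a (n ∸ k)
... | no _  = ℤP.≤-refl

Nonneg-δ : Nonneg δ
Nonneg-δ zero    = ℤ.+≤+ z≤n
Nonneg-δ (suc n) = ℤ.+≤+ z≤n

Nonneg-X : ∀ k → Nonneg (X k)
Nonneg-X k = Nonneg-sh k δ Nonneg-δ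

BoundedGF : ℕ → (ℕ → ℤ) → Ser
BoundedGF N g n = Σ∈ (filter (bounded? N) (partitions n)) (λ π → g (#parts π))

HasLargest : ℕ → List ℕ → Set
HasLargest a π = largest π ≡ a

TopPart : ℕ → List ℕ → Set
TopPart k π = HasLargest k π × Bounded k π

topPart? : ∀ k π → Dec (TopPart k π)
topPart? k π = (largest π ℕP.≟ k) ×-dec bounded? k π

-- The partitions with largest part exactly N+1 are (N+1) ∷ π for π with parts ≤ N+1.
BoundedGF-largest : ∀ N (g : ℕ → ℤ) n →
  Σ∈ (filter (topPart? (suc N)) (partitions n)) (λ π → g (#parts π))
  ≡ sh (suc N) (BoundedGF (suc N) (λ a → g (suc a))) n
BoundedGF-largest N g n with suc N ℕP.≤? n
... | no N+1≰n = Σ∈-empty _ _ empty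
  where
  empty : ∀ x → x ∈ filter (topPart? (suc N)) (partitions n) → ⊥
  empty x x∈ with ∈-filter-partitions⁻ (topPart? (suc N)) n x x∈
  empty (y ∷ ys) _ | (_ , _ , s) , (refl , _) = N+1≰n (subst (suc N ≤_) s (ℕP.m≤m+n (suc N) (sum ys)))
... | yes N+1≤n = Σ∈-partition-bijection n (n ∸ suc N) (topPart? (suc N)) (bounded? (suc N)) (suc N ∷_) into onto inj
                    (λ π → g (#parts π))
  where
  sum-eq : ∀ ys → sum ys ≡ n ∸ suc N → suc N ℕ.+ sum ys ≡ n
  sum-eq ys s = trans (cong (suc N ℕ.+_) s) (ℕP.m+[n∸m]≡n N+1≤n)
  into : ∀ x → IsPartitionOf (n ∸ suc N) x → Bounded (suc N) x →
         IsPartitionOf n (suc N ∷ x) × TopPart (suc N) (suc N ∷ x)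
  into []       (lk , pos , s) b        = ([-] , s≤s z≤n ∷ [] , sum-eq [] s) , refl , ℕP.≤-refl ∷ []
  into (y ∷ ys) (lk , pos , s) (b ∷ bs) = (b ∷ lk , s≤s z≤n ∷ pos , sum-eq (y ∷ ys) s) , refl , ℕP.≤-refl ∷ b ∷ bs
  onto : ∀ y → IsPartitionOf n y → TopPart (suc N) y →
         ∃ λ x → IsPartitionOf (n ∸ suc N) x × Bounded (suc N) x × (suc N ∷ x) ≡ y
  onto (y ∷ ys) (lk , _ ∷ pos , s) (refl , _ ∷ bs) =
    ys , (Linked.tail lk , pos , trans (sym (ℕP.m+n∸m≡n (suc N) (sum ys))) (cong (_∸ suc N) s)) , bs , refl
  inj : ∀ x y → IsPartitionOf (n ∸ suc N) x → IsPartitionOf (n ∸ suc N) y → suc N ∷ x ≡ suc N ∷ y → x ≡ y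
  inj x y _ _ refl = refl

BoundedGF-suc : ∀ N (g : ℕ → ℤ) n → BoundedGF (suc N) g n ≡ BoundedGF N g n + sh (suc N) (BoundedGF (suc N) (λ a → g (suc a))) n
BoundedGF-suc N g n =
  trans (Σ∈-filter-split (partitions n) (bounded? (suc N)) (bounded? N) (topPart? (suc N)) (λ π → g (#parts π)) cover weaken (λ _ _ → proj₂) disjoint)
        (cong (BoundedGF N g n +_) (BoundedGF-largest N g n))
  where
  cover : ∀ x → x ∈ partitions n → Bounded (suc N) x → Bounded N x ⊎ (TopPart (suc N) x)
  cover []       _  b        = inj₁ []
  cover (y ∷ ys) x∈ (b ∷ bs) with y ℕP.≟ suc N
  ... | yes e  = inj₂ (e , b ∷ bs)
  ... | no y≢  = inj₁ (y≤N ∷ All.map (λ le → ℕP.≤-trans le y≤N) (linked-head (proj₁ (partitions⁻ n _ x∈))))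
    where
    y≤N : y ≤ N
    y≤N = ℕP.≤-pred (ℕP.≤∧≢⇒< b y≢)
  weaken : ∀ x → x ∈ partitions n → Bounded N x → Bounded (suc N) x
  weaken x _ b = All.map ℕP.m≤n⇒m≤1+n b
  disjoint : ∀ x → x ∈ partitions n → Bounded N x → TopPart (suc N) x → ⊥
  disjoint (y ∷ ys) _ (b ∷ _) (refl , _) = ℕP.1+n≰n b

-- Only the empty partition has parts ≤ 0.
BoundedGF-zero : ∀ (g : ℕ → ℤ) n → BoundedGF 0 g n ≡ g 0 * δ n
BoundedGF-zero g zero    = trans (ℤP.+-identityʳ (g 0)) (sym (ℤP.*-identityʳ (g 0)))
BoundedGF-zero g (suc n) = trans (Σ∈-empty _ _ empty) (sym (ℤP.*-zeroʳ (g 0)))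
  where
  empty : ∀ x → x ∈ filter (bounded? 0) (partitions (suc n)) → ⊥
  empty x x∈ with ∈-filter-partitions⁻ (bounded? 0) (suc n) x x∈
  empty []       _ | (_ , _ , ()) , _
  empty (y ∷ ys) _ | (_ , p ∷ _ , _) , (b ∷ _) = ℕP.<⇒≱ p b

BoundedGF-+ : ∀ N (g h : ℕ → ℤ) n → BoundedGF N (λ a → g a + h a) n ≡ BoundedGF N g n + BoundedGF N h n
BoundedGF-+ N g h n = Σ∈-+ (filter (bounded? N) (partitions n)) (λ π → g (#parts π)) (λ π → h (#parts π))

BoundedGF-ext : ∀ N (g h : ℕ → ℤ) → (∀ a → g a ≡ h a) → ∀ n → BoundedGF N g n ≡ BoundedGF N h n
BoundedGF-ext N g h e n = Σ∈-ext (filter (bounded? N) (partitions n)) (λ π → e (#parts π))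

F₀ F₁ F₂ : ℕ → Ser
F₀ j = BoundedGF j (λ _ → 1ℤ)
F₁ j = BoundedGF j (λ a → ℤ.+ a)
F₂ j = BoundedGF j (λ a → ℤ.+ a * ℤ.+ a)

F₀-cong : ∀ {a b} → a ≡ b → F₀ a ≋ F₀ b
F₀-cong refl = ≋-refl

F₀-zero : F₀ 0 ≋ δ
F₀-zero = mk≋ (λ n → trans (BoundedGF-zero (λ _ → 1ℤ) n) (ℤP.*-identityˡ (δ n)))

F₁-zero : F₁ 0 ≋ 𝟘
F₁-zero = mk≋ (λ n → trans (BoundedGF-zero (λ a → ℤ.+ a) n) (ℤP.*-zeroˡ (δ n)))

F₂-zero : F₂ 0 ≋ 𝟘
F₂-zero = mk≋ (λ n → trans (BoundedGF-zero (λ a → ℤ.+ a * ℤ.+ a) n) (ℤP.*-zeroˡ (δ n)))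

pos-suc : ∀ a → ℤ.+ suc a ≡ ℤ.+ a + 1ℤ
pos-suc a = trans (ℤP.pos-+ 1 a) (ℤP.+-comm 1ℤ (ℤ.+ a))

-- The recursions of BoundedGF-suc for the weights 1, a, a², using
-- (a+1) = a + 1 and (a+1)² = a² + 2a + 1.
F₀-suc : ∀ j → F₀ (suc j) ≋ F₀ j ⊕ X (suc j) ⊛ F₀ (suc j)
F₀-suc j = mk≋ (λ n → trans (BoundedGF-suc j (λ _ → 1ℤ) n) (cong (F₀ j n +_) (sh≈X⊛ (suc j) (F₀ (suc j)) n)))

F₁-suc : ∀ j → F₁ (suc j) ≋ F₁ j ⊕ X (suc j) ⊛ (F₁ (suc j) ⊕ F₀ (suc j))
F₁-suc j = mk≋ (λ n → trans (BoundedGF-suc j (λ a → ℤ.+ a) n)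
  (cong (F₁ j n +_) (trans (sh-cong (suc j) expand n) (sh≈X⊛ (suc j) (F₁ (suc j) ⊕ F₀ (suc j)) n))))
  where
  expand : BoundedGF (suc j) (λ a → ℤ.+ suc a) ≈ F₁ (suc j) ⊕ F₀ (suc j)
  expand m = trans (BoundedGF-ext (suc j) _ (λ a → ℤ.+ a + 1ℤ) pos-suc m)
                   (BoundedGF-+ (suc j) (λ a → ℤ.+ a) (λ _ → 1ℤ) m)

F₂-suc : ∀ j → F₂ (suc j) ≋ F₂ j ⊕ X (suc j) ⊛ (F₂ (suc j) ⊕ (F₁ (suc j) ⊕ F₁ (suc j)) ⊕ F₀ (suc j))
F₂-suc j = mk≋ (λ n → trans (BoundedGF-suc j (λ a → ℤ.+ a * ℤ.+ a) n)
  (cong (F₂ j n +_) (trans (sh-cong (suc j) expand n) (sh≈X⊛ (suc j) (F₂ (suc j) ⊕ (F₁ (suc j) ⊕ F₁ (suc j)) ⊕ F₀ (suc j)) n))))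
  where
  square : ∀ x → (x + 1ℤ) * (x + 1ℤ) ≡ (x * x + (x + x)) + 1ℤ
  square = solve-∀
  expand : BoundedGF (suc j) (λ a → ℤ.+ suc a * ℤ.+ suc a) ≈ F₂ (suc j) ⊕ (F₁ (suc j) ⊕ F₁ (suc j)) ⊕ F₀ (suc j)
  expand m = begin
    BoundedGF (suc j) (λ a → ℤ.+ suc a * ℤ.+ suc a) m
      ≡⟨ BoundedGF-ext (suc j) _ (λ a → (ℤ.+ a * ℤ.+ a + (ℤ.+ a + ℤ.+ a)) + 1ℤ)
                       (λ a → trans (cong (λ z → z * z) (pos-suc a)) (square (ℤ.+ a))) m ⟩
    BoundedGF (suc j) (λ a → (ℤ.+ a * ℤ.+ a + (ℤ.+ a + ℤ.+ a)) + 1ℤ) m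
      ≡⟨ BoundedGF-+ (suc j) (λ a → ℤ.+ a * ℤ.+ a + (ℤ.+ a + ℤ.+ a)) (λ _ → 1ℤ) m ⟩
    BoundedGF (suc j) (λ a → ℤ.+ a * ℤ.+ a + (ℤ.+ a + ℤ.+ a)) m + F₀ (suc j) m
      ≡⟨ cong (_+ F₀ (suc j) m) (trans (BoundedGF-+ (suc j) (λ a → ℤ.+ a * ℤ.+ a) (λ a → ℤ.+ a + ℤ.+ a) m)
                                       (cong (F₂ (suc j) m +_) (BoundedGF-+ (suc j) (λ a → ℤ.+ a) (λ a → ℤ.+ a) m))) ⟩
    F₂ (suc j) m + (F₁ (suc j) m + F₁ (suc j) m) + F₀ (suc j) m ∎
    where open ≡-Reasoning

InRange : ℕ → ℕ → List ℕ → Set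
InRange L U π = Distinct π × All (λ x → L ≤ x × x ≤ U) π

inRange? : ∀ L U π → Dec (InRange L U π)
inRange? L U π = distinct? π ×-dec All.all? (λ x → (L ℕP.≤? x) ×-dec (x ℕP.≤? U)) π

signedDistinct : ℕ → ℕ → Ser
signedDistinct L U n = Σ∈ (filter (inRange? L U) (partitions n)) (λ π → sign (#parts π))

TopDistinct : ℕ → ℕ → List ℕ → Set
TopDistinct L U π = HasLargest (suc U) π × InRange L (suc U) π

topDistinct? : ∀ L U π → Dec (TopDistinct L U π)
topDistinct? L U π = (largest π ℕP.≟ suc U) ×-dec inRange? L (suc U) π

signedTop : ℕ → ℕ → Ser
signedTop L U n = Σ∈ (filter (topDistinct? L U) (partitions n)) (λ π → sign (#parts π))

qStep : ∀ {L} k → Dec (L ≤ k) → Ser → Ser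
qStep k (yes _) f = f ⊖ sh k f
qStep k (no _)  f = f

qProd : ℕ → ℕ → Ser
qProd L zero    = δ
qProd L (suc U) = qStep (suc U) (L ℕP.≤? suc U) (qProd L U)

-- With U = 0 only the empty partition remains.
signedDistinct-zero : ∀ L n → signedDistinct L 0 n ≡ δ n
signedDistinct-zero L zero    = refl
signedDistinct-zero L (suc n) = Σ∈-empty _ _ empty
  where
  empty : ∀ x → x ∈ filter (inRange? L 0) (partitions (suc n)) → ⊥
  empty x x∈ with ∈-filter-partitions⁻ (inRange? L 0) (suc n) x x∈
  empty []       _ | (_ , _ , ()) , _
  empty (y ∷ ys) _ | (_ , p ∷ _ , _) , (_ , (_ , b) ∷ _) = ℕP.<⇒≱ p b

-- Parts in [L, U+1] either all lie in [L, U] or the largest one is U+1.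
signedDistinct-suc : ∀ L U n → signedDistinct L (suc U) n ≡ signedDistinct L U n + signedTop L U n
signedDistinct-suc L U n =
  Σ∈-filter-split (partitions n) (inRange? L (suc U)) (inRange? L U) (topDistinct? L U) _ cover weaken (λ _ _ → proj₂) disjoint
  where
  cover : ∀ x → x ∈ partitions n → InRange L (suc U) x → InRange L U x ⊎ TopDistinct L U x
  cover []       _  _                       = inj₁ ([] , [])
  cover (y ∷ ys) x∈ (ds , (L≤y , y≤) ∷ bs) with y ℕP.≟ suc U
  ... | yes e = inj₂ (e , ds , (L≤y , y≤) ∷ bs)
  ... | no y≢ = inj₁ (ds , (L≤y , y≤U) ∷ All.zipWith (λ { ((l , _) , le) → l , ℕP.≤-trans le y≤U })
                                                      (bs , linked-head (proj₁ (partitions⁻ n _ x∈))))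
    where
    y≤U : y ≤ U
    y≤U = ℕP.≤-pred (ℕP.≤∧≢⇒< y≤ y≢)
  weaken : ∀ x → x ∈ partitions n → InRange L U x → InRange L (suc U) x
  weaken x _ (ds , b) = ds , All.map (λ { (l , u) → l , ℕP.m≤n⇒m≤1+n u }) b
  disjoint : ∀ x → x ∈ partitions n → InRange L U x → TopDistinct L U x → ⊥
  disjoint (y ∷ ys) _ (_ , (_ , b) ∷ _) (refl , _) = ℕP.1+n≰n b

signedTop-empty : ∀ L U n → ¬ (L ≤ suc U × suc U ≤ n) → signedTop L U n ≡ 0ℤ
signedTop-empty L U n impossible = Σ∈-empty _ _ empty
  where
  empty : ∀ x → x ∈ filter (topDistinct? L U) (partitions n) → ⊥
  empty x x∈ with ∈-filter-partitions⁻ (topDistinct? L U) n x x∈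
  empty (y ∷ ys) _ | (_ , _ , s) , (refl , _ , (L≤ , _) ∷ _) =
    impossible (L≤ , subst (suc U ≤_) s (ℕP.m≤m+n (suc U) (sum ys)))

-- Removing the largest part U+1 is a bijection onto distinct partitions of
-- n − (U+1) with parts in [L, U], and it flips the sign.
signedTop-remove : ∀ L U n → L ≤ suc U → suc U ≤ n → signedTop L U n ≡ - signedDistinct L U (n ∸ suc U)
signedTop-remove L U n L≤ U+1≤n =
  trans (Σ∈-partition-bijection n (n ∸ suc U) (topDistinct? L U) (inRange? L U) (suc U ∷_) into onto inj
                                (λ π → sign (#parts π)))
        (Σ∈-neg (filter (inRange? L U) (partitions (n ∸ suc U))) (λ π → sign (#parts π)))
  where
  sum-eq : ∀ ys → sum ys ≡ n ∸ suc U → suc U ℕ.+ sum ys ≡ n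
  sum-eq ys s = trans (cong (suc U ℕ.+_) s) (ℕP.m+[n∸m]≡n U+1≤n)
  into : ∀ x → IsPartitionOf (n ∸ suc U) x → InRange L U x → IsPartitionOf n (suc U ∷ x) × TopDistinct L U (suc U ∷ x)
  into []       (lk , pos , s) _ = ([-] , s≤s z≤n ∷ [] , sum-eq [] s) , refl , [-] , (L≤ , ℕP.≤-refl) ∷ []
  into (y ∷ ys) (lk , pos , s) (ds , (l , u) ∷ bs) =
    (ℕP.m≤n⇒m≤1+n u ∷ lk , s≤s z≤n ∷ pos , sum-eq (y ∷ ys) s) , refl ,
    s≤s u ∷ ds , (L≤ , ℕP.≤-refl) ∷ (l , ℕP.m≤n⇒m≤1+n u) ∷ All.map (λ { (a , b) → a , ℕP.m≤n⇒m≤1+n b }) bs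
  onto : ∀ y → IsPartitionOf n y → TopDistinct L U y → ∃ λ x → IsPartitionOf (n ∸ suc U) x × InRange L U x × (suc U ∷ x) ≡ y
  onto (y ∷ ys) (lk , _ ∷ pos , s) (refl , ds , _ ∷ bs) =
    ys , (Linked.tail lk , pos , trans (sym (ℕP.m+n∸m≡n (suc U) (sum ys))) (cong (_∸ suc U) s)) ,
    (Linked.tail ds , All.zipWith (λ { ((l , _) , lt) → l , ℕP.≤-pred lt }) (bs , linked>-head ds)) , refl
  inj : ∀ x y → IsPartitionOf (n ∸ suc U) x → IsPartitionOf (n ∸ suc U) y → suc U ∷ x ≡ suc U ∷ y → x ≡ y
  inj x y _ _ refl = refl

signedDistinct≈qProd : ∀ L U → signedDistinct L U ≈ qProd L U
signedDistinct≈qProd L zero    n = signedDistinct-zero L n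
signedDistinct≈qProd L (suc U) n =
  trans (signedDistinct-suc L U n) (step (L ℕP.≤? suc U))
  where
  IH = signedDistinct≈qProd L U
  step : (d : Dec (L ≤ suc U)) → signedDistinct L U n + signedTop L U n ≡ qStep (suc U) d (qProd L U) n
  step (no L≰) = trans (cong₂ _+_ (IH n) (signedTop-empty L U n (λ p → L≰ (proj₁ p)))) (ℤP.+-identityʳ _)
  step (yes L≤) with suc U ℕP.≤? n
  ... | yes U+1≤n = cong₂ _+_ (IH n) (trans (signedTop-remove L U n L≤ U+1≤n) (cong -_ (IH (n ∸ suc U))))
  ... | no U+1≰n  = cong₂ _+_ (IH n) (signedTop-empty L U n (λ p → U+1≰n (proj₂ p)))

qProd-suc : ∀ L U → L ≤ suc U → qProd L (suc U) ≋ oneMinusX (suc U) ⊛ qProd L U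
qProd-suc L U L≤ with L ℕP.≤? suc U
... | no L≰ = ⊥-elim (L≰ L≤)
... | yes _ = begin
  qProd L U ⊖ sh (suc U) (qProd L U)           ≈⟨ ⊖-cong (≋-refl {qProd L U}) (mk≋ (sh≈X⊛ (suc U) (qProd L U))) ⟩
  qProd L U ⊖ X (suc U) ⊛ qProd L U           ≈⟨ factor (qProd L U) (X (suc U)) ⟩
  (const 1ℤ ⊖ X (suc U)) ⊛ qProd L U          ≈⟨ ⊛-congˡ≋ (qProd L U) (≋-sym (oneMinusX≋ (suc U))) ⟩
  oneMinusX (suc U) ⊛ qProd L U               ∎
  where
  open ≋-Reasoning
  factor : ∀ p x → p ⊖ x ⊛ p ≋ (const 1ℤ ⊖ x) ⊛ p
  factor = solve 2 (λ p x → p :- x :* p := (con 1ℤ :- x) :* p) ≋-refl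

qProd-skip : ∀ L U → ¬ L ≤ suc U → qProd L (suc U) ≋ qProd L U
qProd-skip L U L≰ with L ℕP.≤? suc U
... | yes L≤ = ⊥-elim (L≰ L≤)
... | no _   = ≋-refl

-- These count partitions into at most j parts by largest part; by
-- conjugation this is BoundedGF j, which we prove via equal recursions.

NonincVec : ℕ → ℕ → List ℕ → Set
NonincVec j s v = length v ≡ j × Linked _≥_ v × sum v ≡ s

nonincVec? : ∀ j s v → Dec (NonincVec j s v)
nonincVec? j s v = (length v ℕP.≟ j) ×-dec linked? ℕP._≥?_ v ×-dec (sum v ℕP.≟ s)

nonincVecs : ℕ → ℕ → List (List ℕ)
nonincVecs j s = filter (nonincVec? j s) (candidates j s)

nonincVecs⁺ : ∀ j s v → NonincVec j s v → v ∈ nonincVecs j s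
nonincVecs⁺ j s v p@(l , _ , refl) =
  MP.∈-filter⁺ (nonincVec? j s) (candidates⁺ j (sum v) v (ℕP.≤-reflexive l) (entries≤sum v)) p

nonincVecs⁻ : ∀ j s v → v ∈ nonincVecs j s → NonincVec j s v
nonincVecs⁻ j s v p = proj₂ (MP.∈-filter⁻ (nonincVec? j s) {xs = candidates j s} p)

unique-nonincVecs : ∀ j s → Unique (nonincVecs j s)
unique-nonincVecs j s = UniqueP.filter⁺ (nonincVec? j s) (unique-candidates j s)

VecGF : ℕ → (ℕ → ℤ) → Ser
VecGF j g s = Σ∈ (nonincVecs j s) (λ v → g (largest v))

linked-map : ∀ {f : ℕ → ℕ} → (∀ {a b} → a ≥ b → f a ≥ f b) → ∀ {xs} → Linked _≥_ xs → Linked _≥_ (map f xs)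
linked-map mono l = LinkedP.map⁺ (Linked.map mono l)

sum-map-suc : ∀ w → sum (map suc w) ≡ length w ℕ.+ sum w
sum-map-suc []      = refl
sum-map-suc (x ∷ w) = cong suc (trans (cong (x ℕ.+_) (sum-map-suc w)) (left-comm x (length w) (sum w)))
  where
  left-comm : ∀ a b c → a ℕ.+ (b ℕ.+ c) ≡ b ℕ.+ (a ℕ.+ c)
  left-comm = ℕ-Ring.solve-∀

map-suc-pred : ∀ {v} → All (0 ℕ.<_) v → map suc (map pred v) ≡ v
map-suc-pred []                   = refl
map-suc-pred {suc x ∷ v} (_ ∷ ps) = cong (suc x ∷_) (map-suc-pred ps)

sum-++0 : ∀ u → sum (u ++ [ 0 ]) ≡ sum u
sum-++0 u = trans (SumP.sum-++ u [ 0 ]) (ℕP.+-identityʳ (sum u))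

largest-++0 : ∀ u → largest (u ++ [ 0 ]) ≡ largest u
largest-++0 []      = refl
largest-++0 (x ∷ u) = refl

linked-++0 : ∀ u → Linked _≥_ u → Linked _≥_ (u ++ [ 0 ])
linked-++0 []          _        = [-]
linked-++0 (x ∷ [])    _        = z≤n ∷ [-]
linked-++0 (x ∷ y ∷ u) (le ∷ l) = le ∷ linked-++0 (y ∷ u) l

linked-++0⁻ : ∀ u → Linked _≥_ (u ++ [ 0 ]) → Linked _≥_ u
linked-++0⁻ []          _        = []
linked-++0⁻ (x ∷ [])    _        = [-]
linked-++0⁻ (x ∷ y ∷ u) (le ∷ l) = le ∷ linked-++0⁻ (y ∷ u) l

ends-in-0 : ∀ v → Linked _≥_ v → ¬ All (0 ℕ.<_) v → ∃ λ u → v ≡ u ++ [ 0 ]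
ends-in-0 []            _        no-zero = ⊥-elim (no-zero [])
ends-in-0 (zero ∷ [])   _        _       = [] , refl
ends-in-0 (suc x ∷ [])  _        no-zero = ⊥-elim (no-zero (s≤s z≤n ∷ []))
ends-in-0 (x ∷ y ∷ v) (le ∷ l) no-zero with All.all? (0 ℕP.<?_) (y ∷ v)
... | yes pos@(py ∷ _) = ⊥-elim (no-zero (ℕP.<-≤-trans py le ∷ pos))
... | no  has-zero with ends-in-0 (y ∷ v) l has-zero
...   | u , e = x ∷ u , cong (x ∷_) e

Positive : List ℕ → Set
Positive = All (0 ℕ.<_)

positive? : ∀ v → Dec (Positive v)
positive? = All.all? (0 ℕP.<?_)

-- Vectors with a zero entry are u ++ [0] for a vector u of length j.
VecGF-with-zero : ∀ j (g : ℕ → ℤ) s →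
  Σ∈ (filter (λ v → ¬? (positive? v)) (nonincVecs (suc j) s)) (λ v → g (largest v)) ≡ VecGF j g s
VecGF-with-zero j g s =
  trans (Σ∈-bijection (nonincVecs j s) _ (unique-nonincVecs j s) (UniqueP.filter⁺ _ (unique-nonincVecs (suc j) s))
                      (_++ [ 0 ]) into onto (λ x y _ _ → LP.++-cancelʳ [ 0 ] x y) (λ v → g (largest v)))
        (Σ∈-ext (nonincVecs j s) (λ u → cong g (largest-++0 u)))
  where
  into : ∀ u → u ∈ nonincVecs j s → (u ++ [ 0 ]) ∈ filter (λ v → ¬? (positive? v)) (nonincVecs (suc j) s)
  into u u∈ with nonincVecs⁻ j s u u∈
  ... | l , lk , sm = MP.∈-filter⁺ (λ v → ¬? (positive? v))
      (nonincVecs⁺ (suc j) s _ (trans (LP.length-++ u) (trans (ℕP.+-comm (length u) 1) (cong suc l)) ,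
                                linked-++0 u lk , trans (sum-++0 u) sm))
      (λ pos → ℕP.<-irrefl refl (All.head (AllP.++⁻ʳ u pos)))
  onto : ∀ v → v ∈ filter (λ v → ¬? (positive? v)) (nonincVecs (suc j) s) → ∃ λ u → u ∈ nonincVecs j s × u ++ [ 0 ] ≡ v
  onto v v∈ with MP.∈-filter⁻ (λ v → ¬? (positive? v)) {xs = nonincVecs (suc j) s} v∈
  ... | v∈′ , has-zero with nonincVecs⁻ (suc j) s v v∈′
  ... | l , lk , sm with ends-in-0 v lk has-zero
  ... | u , refl =
    u , nonincVecs⁺ j s u (ℕP.suc-injective (trans (trans (ℕP.+-comm 1 (length u)) (sym (LP.length-++ u))) l) ,
                           linked-++0⁻ u lk , trans (sym (sum-++0 u)) sm) , refl

-- Positive vectors are map suc w for a vector w of sum s − (j+1).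
VecGF-positive : ∀ j (g : ℕ → ℤ) s →
  Σ∈ (filter positive? (nonincVecs (suc j) s)) (λ v → g (largest v)) ≡ sh (suc j) (VecGF (suc j) (λ a → g (suc a))) s
VecGF-positive j g s with suc j ℕP.≤? s
... | no j+1≰s = Σ∈-empty _ _ empty
  where
  empty : ∀ v → v ∈ filter positive? (nonincVecs (suc j) s) → ⊥
  empty v v∈ with MP.∈-filter⁻ positive? {xs = nonincVecs (suc j) s} v∈
  ... | v∈′ , pos with nonincVecs⁻ (suc j) s v v∈′
  ... | l , _ , sm = j+1≰s (subst₂ _≤_ l sm (length≤sum v pos))
... | yes j+1≤s =
  trans (Σ∈-bijection (nonincVecs (suc j) (s ∸ suc j)) _ (unique-nonincVecs (suc j) (s ∸ suc j))
                      (UniqueP.filter⁺ positive? (unique-nonincVecs (suc j) s)) (map suc) into onto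
                      (λ x y _ _ → LP.map-injective ℕP.suc-injective) (λ v → g (largest v)))
        (Σ∈-cong (nonincVecs (suc j) (s ∸ suc j)) first)
  where
  first : ∀ w → w ∈ nonincVecs (suc j) (s ∸ suc j) → g (largest (map suc w)) ≡ g (suc (largest w))
  first []      w∈ with nonincVecs⁻ (suc j) (s ∸ suc j) [] w∈
  ... | () , _
  first (x ∷ w) _ = refl
  into : ∀ w → w ∈ nonincVecs (suc j) (s ∸ suc j) → map suc w ∈ filter positive? (nonincVecs (suc j) s)
  into w w∈ with nonincVecs⁻ _ _ w w∈
  ... | l , lk , sm = MP.∈-filter⁺ positive?
      (nonincVecs⁺ (suc j) s _ (trans (LP.length-map suc w) l , linked-map s≤s lk ,
                                trans (sum-map-suc w) (trans (cong₂ ℕ._+_ l sm) (ℕP.m+[n∸m]≡n j+1≤s))))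
      (AllP.map⁺ (All.universal (λ _ → s≤s z≤n) w))
  onto : ∀ v → v ∈ filter positive? (nonincVecs (suc j) s) → ∃ λ w → w ∈ nonincVecs (suc j) (s ∸ suc j) × map suc w ≡ v
  onto v v∈ with MP.∈-filter⁻ positive? {xs = nonincVecs (suc j) s} v∈
  ... | v∈′ , pos with nonincVecs⁻ (suc j) s v v∈′
  ... | l , lk , sm =
    map pred v , nonincVecs⁺ _ _ _ (trans (LP.length-map pred v) l , linked-map ℕP.pred-mono-≤ lk , sum-pred) ,
    map-suc-pred pos
    where
    sum-pred : sum (map pred v) ≡ s ∸ suc j
    sum-pred = begin
      sum (map pred v)                                        ≡⟨ sym (ℕP.m+n∸m≡n (length (map pred v)) _) ⟩
      length (map pred v) ℕ.+ sum (map pred v) ∸ length (map pred v)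
        ≡⟨ cong₂ _∸_ (sym (sum-map-suc (map pred v))) (LP.length-map pred v) ⟩
      sum (map suc (map pred v)) ∸ length v                   ≡⟨ cong₂ _∸_ (trans (cong sum (map-suc-pred pos)) sm) l ⟩
      s ∸ suc j                                               ∎
      where open ≡-Reasoning

VecGF-suc : ∀ j (g : ℕ → ℤ) s → VecGF (suc j) g s ≡ VecGF j g s + sh (suc j) (VecGF (suc j) (λ a → g (suc a))) s
VecGF-suc j g s = trans (Σ∈-split positive? (nonincVecs (suc j) s) (λ v → g (largest v)))
                        (cong₂ _+_ (VecGF-with-zero j g s) (VecGF-positive j g s))

VecGF-zero : ∀ (g : ℕ → ℤ) s → VecGF 0 g s ≡ g 0 * δ s
VecGF-zero g zero    = trans (ℤP.+-identityʳ (g 0)) (sym (ℤP.*-identityʳ (g 0)))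
VecGF-zero g (suc s) = sym (ℤP.*-zeroʳ (g 0))

-- Conjugation, in generating-function form: both sides satisfy the same
-- recursion in j, and in s the shift by j+1 ≥ 1 makes the recursion well-founded.
VecGF≡BoundedGF : ∀ j g s → VecGF j g s ≡ BoundedGF j g s
VecGF≡BoundedGF zero    g s = trans (VecGF-zero g s) (sym (BoundedGF-zero g s))
VecGF≡BoundedGF (suc j) g s = <-rec (λ s → ∀ g → VecGF (suc j) g s ≡ BoundedGF (suc j) g s) step s g
  where
  step : ∀ s → (∀ {t} → t ℕ.< s → ∀ g → VecGF (suc j) g t ≡ BoundedGF (suc j) g t) →
         ∀ g → VecGF (suc j) g s ≡ BoundedGF (suc j) g s
  step s IH g = trans (VecGF-suc j g s) (trans (cong₂ _+_ (VecGF≡BoundedGF j g s) shifted) (sym (BoundedGF-suc j g s)))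
    where
    shifted : sh (suc j) (VecGF (suc j) (λ a → g (suc a))) s ≡ sh (suc j) (BoundedGF (suc j) (λ a → g (suc a))) s
    shifted with suc j ℕP.≤? s
    ... | no _    = refl
    ... | yes j<s = IH (ℕP.∸-monoʳ-< {o = 0} (s≤s z≤n) j<s) (λ a → g (suc a))

-- A partition with Durfee square j ≥ 1 is
-- glue j (α , β) = map (j +_) α ++ β, where α is a non-increasing vector of
-- length j (the arm to the right of the square) and β has parts ≤ j (the
-- legs below it).  Its size is j² + |α| + |β| and its rank is α₁ − #β.

glue : ℕ → List ℕ × List ℕ → List ℕ
glue j (α , β) = map (j ℕ.+_) α ++ β

durfeeFrom-glue : ∀ K i α β → i ℕ.+ length α ≤ K → All (_≤ i ℕ.+ length α) β →
  durfeeFrom i (map (K ℕ.+_) α ++ β) ≡ length α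
durfeeFrom-glue K i []      []      le al = refl
durfeeFrom-glue K i []      (b ∷ β) le (b≤i ∷ _) with suc i ℕP.≤? b
... | yes i<b = ⊥-elim (ℕP.<⇒≱ i<b (subst (b ≤_) (ℕP.+-identityʳ i) b≤i))
... | no _    = refl
durfeeFrom-glue K i (a ∷ α) β le al with suc i ℕP.≤? K ℕ.+ a
... | yes _ = cong suc (durfeeFrom-glue K (suc i) α β (subst (_≤ K) (ℕP.+-suc i (length α)) le)
                                           (subst (λ z → All (_≤ z) β) (ℕP.+-suc i (length α)) al))
... | no i≮ = ⊥-elim (i≮ (ℕP.≤-trans (ℕP.≤-trans (s≤s (ℕP.m≤m+n i (length α)))
                                                   (ℕP.≤-reflexive (sym (ℕP.+-suc i (length α)))))
                                      (ℕP.≤-trans le (ℕP.m≤m+n K a))))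

durfeeFrom-split : ∀ i λ′ d → Linked _≥_ λ′ → durfeeFrom i λ′ ≡ d →
  d ≤ length λ′ × All (i ℕ.+ d ≤_) (take d λ′) × All (_≤ i ℕ.+ d) (drop d λ′)
durfeeFrom-split i []       d lk refl = z≤n , [] , []
durfeeFrom-split i (x ∷ xs) d lk e with suc i ℕP.≤? x
durfeeFrom-split i (x ∷ xs) d lk e | no i≮x rewrite sym e =
  z≤n , [] , x≤i ∷ All.map (λ le → ℕP.≤-trans le x≤i) (linked-head lk)
  where
  x≤i : x ≤ i ℕ.+ 0
  x≤i = subst (x ≤_) (sym (ℕP.+-identityʳ i)) (ℕP.≤-pred (ℕP.≰⇒> i≮x))
durfeeFrom-split i (x ∷ xs) d lk e | yes i<x with durfeeFrom-split (suc i) xs _ (Linked.tail lk) refl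
... | le , tk , dr rewrite sym e =
  s≤s le , head-ok xs (durfeeFrom (suc i) xs) le lk tk ∷ subst (λ z → All (z ≤_) (take d′ xs)) shift tk ,
  subst (λ z → All (_≤ z) (drop d′ xs)) shift dr
  where
  d′ = durfeeFrom (suc i) xs
  shift : suc i ℕ.+ d′ ≡ i ℕ.+ suc d′
  shift = sym (ℕP.+-suc i d′)
  head-ok : ∀ xs d″ → d″ ≤ length xs → Linked _≥_ (x ∷ xs) → All (suc i ℕ.+ d″ ≤_) (take d″ xs) → i ℕ.+ suc d″ ≤ x
  head-ok xs       zero     _ _        _       = subst (_≤ x) (ℕP.+-comm 1 i) i<x
  head-ok (y ∷ ys) (suc d″) _ (yx ∷ _) (p ∷ _) = ℕP.≤-trans (ℕP.≤-reflexive (ℕP.+-suc i (suc d″))) (ℕP.≤-trans p yx)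

sum-map-+ : ∀ j α → sum (map (j ℕ.+_) α) ≡ length α ℕ.* j ℕ.+ sum α
sum-map-+ j []      = refl
sum-map-+ j (a ∷ α) = trans (cong ((j ℕ.+ a) ℕ.+_) (sum-map-+ j α)) (regroup j a (length α ℕ.* j) (sum α))
  where
  regroup : ∀ j a b c → (j ℕ.+ a) ℕ.+ (b ℕ.+ c) ≡ (j ℕ.+ b) ℕ.+ (a ℕ.+ c)
  regroup = ℕ-Ring.solve-∀

linked-take : ∀ {R : ℕ → ℕ → Set} n xs → Linked R xs → Linked R (take n xs)
linked-take zero          xs           _       = []
linked-take (suc n)       []           _       = []
linked-take (suc zero)    (x ∷ xs)     _       = [-]
linked-take (suc (suc n)) (x ∷ [])     _       = [-]
linked-take (suc (suc n)) (x ∷ y ∷ xs) (r ∷ l) = r ∷ linked-take (suc n) (y ∷ xs) l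

linked-drop : ∀ {R : ℕ → ℕ → Set} n xs → Linked R xs → Linked R (drop n xs)
linked-drop zero    xs       l = l
linked-drop (suc n) []       _ = []
linked-drop (suc n) (x ∷ xs) l = linked-drop n xs (Linked.tail l)

linked-++ : ∀ j xs ys → Linked _≥_ xs → Linked _≥_ ys → All (j ≤_) xs → All (_≤ j) ys → Linked _≥_ (xs ++ ys)
linked-++ j []            ys _        l  _        _          = l
linked-++ j (x ∷ [])      []       _  _  _        _          = [-]
linked-++ j (x ∷ [])      (y ∷ ys) _  l  (jx ∷ _) (yj ∷ _)   = ℕP.≤-trans yj jx ∷ l
linked-++ j (x ∷ x′ ∷ xs) ys (le ∷ l) l′ (_ ∷ a)  b          = le ∷ linked-++ j (x′ ∷ xs) ys l l′ a b

++-injective-length : ∀ (xs xs′ ys ys′ : List ℕ) → length xs ≡ length xs′ → xs ++ ys ≡ xs′ ++ ys′ → xs ≡ xs′ × ys ≡ ys′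
++-injective-length []       []         ys ys′ _ e = refl , e
++-injective-length (x ∷ xs) (x′ ∷ xs′) ys ys′ l e
  with ++-injective-length xs xs′ ys ys′ (ℕP.suc-injective l) (LP.∷-injectiveʳ e)
... | p , q = cong₂ _∷_ (LP.∷-injectiveˡ e) p , q

map-+-∸ : ∀ j {xs} → All (j ≤_) xs → map (j ℕ.+_) (map (_∸ j) xs) ≡ xs
map-+-∸ j []       = refl
map-+-∸ j (p ∷ ps) = cong₂ _∷_ (ℕP.m+[n∸m]≡n p) (map-+-∸ j ps)

all-+ : ∀ j xs → All (j ≤_) (map (j ℕ.+_) xs)
all-+ j xs = AllP.map⁺ (All.universal (ℕP.m≤m+n j) xs)

boundedPartitions : ℕ → ℕ → List (List ℕ)
boundedPartitions j m = filter (bounded? j) (partitions m)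

squarePairs : ℕ → ℕ → List (List ℕ × List ℕ)
squarePairs j t = concatMap (λ s → concatMap (λ α → map (α ,_) (boundedPartitions j (t ∸ s))) (nonincVecs j s)) (upTo (suc t))

-- Membership in squarePairs and its duplicate-freeness (pairs are tagged by |α|).
squarePairs⁻ : ∀ j t α β → (α , β) ∈ squarePairs j t →
  ∃ λ s → s ≤ t × α ∈ nonincVecs j s × β ∈ boundedPartitions j (t ∸ s)
squarePairs⁻ j t α β p
  with find (MP.∈-concatMap⁻ (λ s → concatMap (λ α → map (α ,_) (boundedPartitions j (t ∸ s))) (nonincVecs j s)) {xs = upTo (suc t)} p)
... | s , s∈ , p₁ with find (MP.∈-concatMap⁻ (λ α → map (α ,_) (boundedPartitions j (t ∸ s))) {xs = nonincVecs j s} p₁)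
... | α′ , α∈ , p₂ with MP.∈-map⁻ (α′ ,_) p₂
... | β′ , β∈ , refl = s , ℕP.≤-pred (MP.∈-upTo⁻ s∈) , α∈ , β∈

squarePairs⁺ : ∀ j t s α β → s ≤ t → α ∈ nonincVecs j s → β ∈ boundedPartitions j (t ∸ s) → (α , β) ∈ squarePairs j t
squarePairs⁺ j t s α β le α∈ β∈ =
  MP.∈-concatMap⁺ (λ s → concatMap (λ α → map (α ,_) (boundedPartitions j (t ∸ s))) (nonincVecs j s)) {xs = upTo (suc t)}
    (Any.map (λ { refl → MP.∈-concatMap⁺ (λ α → map (α ,_) (boundedPartitions j (t ∸ s))) {xs = nonincVecs j s}
       (Any.map (λ { refl → MP.∈-map⁺ (α ,_) β∈ }) α∈) }) (MP.∈-upTo⁺ (s≤s le)))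

unique-squarePairs : ∀ j t → Unique (squarePairs j t)
unique-squarePairs j t = unique-concatMap _ (λ p → sum (proj₁ p)) (upTo (suc t)) (UniqueP.upTo⁺ (suc t)) inner tag-sum
  where
  inner : ∀ s → Unique (concatMap (λ α → map (α ,_) (boundedPartitions j (t ∸ s))) (nonincVecs j s))
  inner s = unique-concatMap _ proj₁ (nonincVecs j s) (unique-nonincVecs j s)
    (λ α → UniqueP.map⁺ ,-injectiveʳ (UniqueP.filter⁺ (bounded? j) (unique-partitions (t ∸ s)))) tag-arm
    where
    tag-arm : ∀ α y → y ∈ map (α ,_) (boundedPartitions j (t ∸ s)) → proj₁ y ≡ α
    tag-arm α y y∈ with MP.∈-map⁻ (α ,_) y∈
    ... | _ , _ , refl = refl
  tag-sum : ∀ s y → y ∈ concatMap (λ α → map (α ,_) (boundedPartitions j (t ∸ s))) (nonincVecs j s) → sum (proj₁ y) ≡ s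
  tag-sum s y y∈ with find (MP.∈-concatMap⁻ (λ α → map (α ,_) (boundedPartitions j (t ∸ s))) {xs = nonincVecs j s} y∈)
  ... | α , α∈ , p with MP.∈-map⁻ (α ,_) p
  ... | _ , _ , refl = proj₂ (proj₂ (nonincVecs⁻ j s α α∈))

sum-glue : ∀ j α β → length α ≡ j → sum (glue j (α , β)) ≡ (j ℕ.* j ℕ.+ sum α) ℕ.+ sum β
sum-glue j α β lα = begin
  sum (map (j ℕ.+_) α ++ β)                         ≡⟨ SumP.sum-++ (map (j ℕ.+_) α) β ⟩
  sum (map (j ℕ.+_) α) ℕ.+ sum β                     ≡⟨ cong (ℕ._+ sum β) (sum-map-+ j α) ⟩
  (length α ℕ.* j ℕ.+ sum α) ℕ.+ sum β              ≡⟨ cong (λ z → (z ℕ.* j ℕ.+ sum α) ℕ.+ sum β) lα ⟩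
  (j ℕ.* j ℕ.+ sum α) ℕ.+ sum β                     ∎
  where open ≡-Reasoning

glue-durfee : ∀ j α β → 1 ≤ j → NonincVec j (sum α) α → IsPartitionOf (sum β) β → Bounded j β →
  IsPartitionOf (sum (glue j (α , β))) (glue j (α , β)) × durfee (glue j (α , β)) ≡ j
glue-durfee j α β 1≤j (lα , lkα , _) (lkβ , posβ , _) bd =
  (linked-++ j (map (j ℕ.+_) α) β (linked-map (ℕP.+-monoʳ-≤ j) lkα) lkβ (all-+ j α) bd ,
   AllP.++⁺ (All.map (ℕP.≤-trans 1≤j) (all-+ j α)) posβ , refl) ,
  trans (durfeeFrom-glue j 0 α β (ℕP.≤-reflexive lα) (subst (λ z → All (_≤ z) β) (sym lα) bd)) lα

durfee-decompose : ∀ j r λ′ → IsPartitionOf r λ′ → durfee λ′ ≡ j →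
  let α = map (_∸ j) (take j λ′) ; β = drop j λ′ in
  glue j (α , β) ≡ λ′ × NonincVec j (sum α) α × IsPartitionOf (sum β) β × Bounded j β ×
  r ≡ (j ℕ.* j ℕ.+ sum α) ℕ.+ sum β
durfee-decompose j r λ′ (lk , pos , sm) e with durfeeFrom-split 0 λ′ j lk e
... | j≤len , tk , dr =
  glued , (lenα , linked-map (ℕP.∸-monoˡ-≤ j) (linked-take j λ′ lk) , refl) ,
  (linked-drop j λ′ lk , AllP.drop⁺ j pos , refl) , dr ,
  trans (sym sm) (trans (cong sum (sym glued)) (sum-glue j α (drop j λ′) lenα))
  where
  α = map (_∸ j) (take j λ′)
  glued : glue j (α , drop j λ′) ≡ λ′
  glued = trans (cong (_++ drop j λ′) (map-+-∸ j tk)) (LP.take++drop≡id j λ′)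
  lenα : length α ≡ j
  lenα = trans (LP.length-map (_∸ j) (take j λ′)) (trans (LP.length-take j λ′) (ℕP.m≤n⇒m⊓n≡m j≤len))

rank-glue : ∀ j α β → length α ≡ j → 1 ≤ j → rank (glue j (α , β)) ≡ ℤ.+ largest α - ℤ.+ length β
rank-glue j []      β refl ()
rank-glue j (a ∷ α) β l _ = begin
  ℤ.+ (j ℕ.+ a) - ℤ.+ length (map (j ℕ.+_) (a ∷ α) ++ β)
    ≡⟨ cong (λ z → ℤ.+ (j ℕ.+ a) - ℤ.+ z) (trans (LP.length-++ (map (j ℕ.+_) (a ∷ α)))
                                                 (cong (ℕ._+ length β) (trans (LP.length-map _ (a ∷ α)) l))) ⟩
  ℤ.+ (j ℕ.+ a) - ℤ.+ (j ℕ.+ length β)                  ≡⟨ cong₂ _-_ (ℤP.pos-+ j a) (ℤP.pos-+ j (length β)) ⟩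
  (ℤ.+ j + ℤ.+ a) - (ℤ.+ j + ℤ.+ length β)               ≡⟨ cancel (ℤ.+ j) (ℤ.+ a) (ℤ.+ length β) ⟩
  ℤ.+ a - ℤ.+ length β                                    ∎
  where
  open ≡-Reasoning
  cancel : ∀ x y z → (x + y) - (x + z) ≡ y - z
  cancel = solve-∀

HasDurfee : ℕ → List ℕ → Set
HasDurfee j λ′ = durfee λ′ ≡ j

hasDurfee? : ∀ j λ′ → Dec (HasDurfee j λ′)
hasDurfee? j λ′ = durfee λ′ ℕP.≟ j

-- Partitions with Durfee square j have size ≥ j².
Σ-durfee-small : ∀ j (F : List ℕ → ℤ) r → ¬ j ℕ.* j ≤ r → Σ∈ (filter (hasDurfee? j) (partitions r)) F ≡ 0ℤ
Σ-durfee-small j F r j²≰r = Σ∈-empty _ F empty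
  where
  empty : ∀ x → x ∈ filter (hasDurfee? j) (partitions r) → ⊥
  empty x x∈ with ∈-filter-partitions⁻ (hasDurfee? j) r x x∈
  ... | p , d with durfee-decompose j r x p d
  ... | _ , _ , _ , _ , size = j²≰r (subst (j ℕ.* j ≤_) (sym size) (ℕP.≤-trans (ℕP.m≤m+n (j ℕ.* j) _) (ℕP.m≤m+n _ _)))

squarePairs-arm : ∀ j t α β → (α , β) ∈ squarePairs j t → length α ≡ j
squarePairs-arm j t α β p∈ = arm (squarePairs⁻ j t α β p∈)
  where
  arm : (∃ λ s → s ≤ t × α ∈ nonincVecs j s × β ∈ boundedPartitions j (t ∸ s)) → length α ≡ j
  arm (s , _ , α∈ , _) = proj₁ (nonincVecs⁻ j s α α∈)

glue-injective : ∀ j α β α′ β′ → length α ≡ j → length α′ ≡ j → glue j (α , β) ≡ glue j (α′ , β′) → (α , β) ≡ (α′ , β′)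
glue-injective j α β α′ β′ lα lα′ e =
  cong₂ _,_ (LP.map-injective (ℕP.+-cancelˡ-≡ j _ _) (proj₁ split)) (proj₂ split)
  where
  split = ++-injective-length (map (j ℕ.+_) α) (map (j ℕ.+_) α′) β β′
            (trans (LP.length-map _ α) (trans lα (sym (trans (LP.length-map _ α′) lα′)))) e

glue-into : ∀ j → 1 ≤ j → ∀ t s α β → s ≤ t → NonincVec j s α → IsPartitionOf (t ∸ s) β → Bounded j β →
  IsPartitionOf (j ℕ.* j ℕ.+ t) (glue j (α , β)) × HasDurfee j (glue j (α , β))
glue-into j 1≤j t s α β s≤t vα@(lα , lkα , refl) pβ@(lkβ , posβ , sβ) bd =
  (proj₁ glued , proj₁ (proj₂ glued) , size) , proj₂ (glue-durfee j α β 1≤j vα (lkβ , posβ , refl) bd)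
  where
  glued : IsPartitionOf (sum (glue j (α , β))) (glue j (α , β))
  glued = proj₁ (glue-durfee j α β 1≤j vα (lkβ , posβ , refl) bd)
  size : sum (glue j (α , β)) ≡ j ℕ.* j ℕ.+ t
  size = begin
    sum (glue j (α , β))                 ≡⟨ sum-glue j α β lα ⟩
    (j ℕ.* j ℕ.+ s) ℕ.+ sum β            ≡⟨ cong ((j ℕ.* j ℕ.+ s) ℕ.+_) sβ ⟩
    (j ℕ.* j ℕ.+ s) ℕ.+ (t ∸ s)          ≡⟨ ℕP.+-assoc (j ℕ.* j) s (t ∸ s) ⟩
    j ℕ.* j ℕ.+ (s ℕ.+ (t ∸ s))          ≡⟨ cong (j ℕ.* j ℕ.+_) (ℕP.m+[n∸m]≡n s≤t) ⟩
    j ℕ.* j ℕ.+ t                        ∎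
    where open ≡-Reasoning

Σ-durfee-large : ∀ j → 1 ≤ j → (F : List ℕ → ℤ) → ∀ r → j ℕ.* j ≤ r →
  Σ∈ (filter (hasDurfee? j) (partitions r)) F ≡
  (Σ≤ (r ∸ j ℕ.* j) λ s → Σ∈ (nonincVecs j s) λ α → Σ∈ (boundedPartitions j (r ∸ j ℕ.* j ∸ s)) λ β → F (glue j (α , β)))
Σ-durfee-large j 1≤j F r j²≤r =
  trans (Σ∈-bijection (squarePairs j t) (filter (hasDurfee? j) (partitions r)) (unique-squarePairs j t)
                      (UniqueP.filter⁺ (hasDurfee? j) (unique-partitions r)) (glue j) into onto inj F)
        unfold
  where
  t = r ∸ j ℕ.* j
  pairsWithArm : ℕ → List ℕ → List (List ℕ × List ℕ)
  pairsWithArm s α = map (α ,_) (boundedPartitions j (t ∸ s))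
  unfold : Σ∈ (squarePairs j t) (λ p → F (glue j p)) ≡
           Σ≤ t λ s → Σ∈ (nonincVecs j s) λ α → Σ∈ (boundedPartitions j (t ∸ s)) λ β → F (glue j (α , β))
  unfold = trans (Σ∈-concatMap (λ s → concatMap (pairsWithArm s) (nonincVecs j s)) (upTo (suc t)) (λ p → F (glue j p)))
           (Σ∈-ext (upTo (suc t)) λ s →
           trans (Σ∈-concatMap (pairsWithArm s) (nonincVecs j s) (λ p → F (glue j p))) (Σ∈-ext (nonincVecs j s) λ α →
           Σ∈-map (α ,_) (boundedPartitions j (t ∸ s)) (λ p → F (glue j p))))
  into : ∀ p → p ∈ squarePairs j t → glue j p ∈ filter (hasDurfee? j) (partitions r)
  into (α , β) p∈ = member (squarePairs⁻ j t α β p∈)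
    where
    member : (∃ λ s → s ≤ t × α ∈ nonincVecs j s × β ∈ boundedPartitions j (t ∸ s)) →
             glue j (α , β) ∈ filter (hasDurfee? j) (partitions r)
    member (s , s≤t , α∈ , β∈) with ∈-filter-partitions⁻ (bounded? j) (t ∸ s) β β∈
    ... | pβ , bd with glue-into j 1≤j t s α β s≤t (nonincVecs⁻ j s α α∈) pβ bd
    ... | pglued , dur =
      ∈-filter-partitions⁺ (hasDurfee? j) r _ (subst (λ m → IsPartitionOf m (glue j (α , β))) (ℕP.m+[n∸m]≡n j²≤r) pglued) dur
  onto : ∀ y → y ∈ filter (hasDurfee? j) (partitions r) → ∃ λ p → p ∈ squarePairs j t × glue j p ≡ y
  onto y y∈ with ∈-filter-partitions⁻ (hasDurfee? j) r y y∈
  ... | py , d with durfee-decompose j r y py d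
  ... | glued , vα , pβ , bd , size = (α , β) , squarePairs⁺ j t s α β s≤t (nonincVecs⁺ j s α vα) β∈ , glued
    where
    α = map (_∸ j) (take j y)
    β = drop j y
    s = sum α
    t≡ : t ≡ s ℕ.+ sum β
    t≡ = trans (cong (_∸ j ℕ.* j) (trans size (ℕP.+-assoc (j ℕ.* j) s (sum β)))) (ℕP.m+n∸m≡n (j ℕ.* j) (s ℕ.+ sum β))
    s≤t : s ≤ t
    s≤t = subst (s ≤_) (sym t≡) (ℕP.m≤m+n s (sum β))
    β∈ : β ∈ boundedPartitions j (t ∸ s)
    β∈ = ∈-filter-partitions⁺ (bounded? j) (t ∸ s) β
           (proj₁ pβ , proj₁ (proj₂ pβ) , trans (sym (ℕP.m+n∸m≡n s (sum β))) (cong (_∸ s) (sym t≡))) bd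
  inj : ∀ p q → p ∈ squarePairs j t → q ∈ squarePairs j t → glue j p ≡ glue j q → p ≡ q
  inj (α , β) (α′ , β′) p∈ q∈ = glue-injective j α β α′ β′ (squarePairs-arm j t α β p∈) (squarePairs-arm j t α′ β′ q∈)

Σ-durfee : ∀ j → 1 ≤ j → (F : List ℕ → ℤ) →
  (λ r → Σ∈ (filter (hasDurfee? j) (partitions r)) F) ≈
  sh (j ℕ.* j) (λ t → Σ≤ t λ s → Σ∈ (nonincVecs j s) λ α → Σ∈ (boundedPartitions j (t ∸ s)) λ β → F (glue j (α , β)))
Σ-durfee j 1≤j F r with j ℕ.* j ℕP.≤? r
... | yes j²≤r = Σ-durfee-large j 1≤j F r j²≤r
... | no j²≰r  = Σ-durfee-small j F r j²≰r

WithinRange : ℕ → ℤ → Set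
WithinRange n d = ∃ λ i → i ≤ n ℕ.+ n × d ≡ ℤ.+ i - ℤ.+ n

difference-within : ∀ n a b → a ≤ n → b ≤ n → WithinRange n (ℤ.+ a - ℤ.+ b)
difference-within n a b a≤ b≤ = a ℕ.+ (n ∸ b) , ℕP.+-mono-≤ a≤ (ℕP.m∸n≤m n b) , shifted
  where
  shifted : ℤ.+ a - ℤ.+ b ≡ ℤ.+ (a ℕ.+ (n ∸ b)) - ℤ.+ n
  shifted = begin
    ℤ.+ a - ℤ.+ b                                ≡⟨ add-both (ℤ.+ a) (ℤ.+ b) (ℤ.+ (n ∸ b)) ⟩
    (ℤ.+ a + ℤ.+ (n ∸ b)) - (ℤ.+ (n ∸ b) + ℤ.+ b) ≡⟨ cong₂ _-_ (sym (ℤP.pos-+ a (n ∸ b)))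
                                                     (trans (sym (ℤP.pos-+ (n ∸ b) b)) (cong ℤ.+_ (ℕP.m∸n+n≡m b≤))) ⟩
    ℤ.+ (a ℕ.+ (n ∸ b)) - ℤ.+ n                   ∎
    where
    open ≡-Reasoning
    add-both : ∀ x y z → x - y ≡ (x + z) - (z + y)
    add-both = solve-∀

index-injective : ∀ n i i′ → ℤ.+ i - ℤ.+ n ≡ ℤ.+ i′ - ℤ.+ n → i ≡ i′
index-injective n i i′ e =
  ℤP.+-injective (trans (add-back (ℤ.+ i) (ℤ.+ n)) (trans (cong (_+ ℤ.+ n) e) (sym (add-back (ℤ.+ i′) (ℤ.+ n)))))
  where
  add-back : ∀ x c → x ≡ (x - c) + c
  add-back = solve-∀

Σrange-Σ∈ : ∀ {A : Set} n (xs : List A) (Φ : A → ℤ → ℤ) →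
  Σrange n (λ m → m * m * Σ∈ xs (λ x → Φ x m)) ≡ Σ∈ xs (λ x → Σrange n (λ m → m * m * Φ x m))
Σrange-Σ∈ n xs Φ =
  trans (Σ∈-ext (upTo (suc (n ℕ.+ n))) (λ i → sym (Σ∈-*ˡ xs (m i * m i) (λ x → Φ x (m i)))))
        (Σ∈-swap (upTo (suc (n ℕ.+ n))) xs (λ i x → m i * m i * Φ x (m i)))
  where
  m : ℕ → ℤ
  m i = ℤ.+ i - ℤ.+ n

Σrange-point : ∀ n (d c : ℤ) → WithinRange n d →
  Σrange n (λ m → m * m * (if does (d ℤP.≟ m) then c else 0ℤ)) ≡ d * d * c
Σrange-point n d c (i₀ , i₀≤ , d≡) = begin
  Σ∈ U (λ i → m i * m i * (if does (d ℤP.≟ m i) then c else 0ℤ)) ≡⟨ Σ∈-ext U pointwise ⟩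
  Σ∈ U (λ i → when hit? i (m i * m i * c))                        ≡⟨ sym (Σ∈-filter hit? U _) ⟩
  Σ∈ (filter hit? U) (λ i → m i * m i * c)                        ≡⟨ Σ∈-bijection [ i₀ ] (filter hit? U) ([] ∷ [])
                                                                      (UniqueP.filter⁺ hit? (UniqueP.upTo⁺ (suc (n ℕ.+ n))))
                                                                      (λ i → i) into onto (λ _ _ _ _ e → e) _ ⟩
  m i₀ * m i₀ * c + 0ℤ                                            ≡⟨ ℤP.+-identityʳ _ ⟩
  m i₀ * m i₀ * c                                                 ≡⟨ cong (λ z → z * z * c) (sym d≡) ⟩
  d * d * c                                                       ∎
  where
  open ≡-Reasoning
  U = upTo (suc (n ℕ.+ n))
  m : ℕ → ℤ
  m i = ℤ.+ i - ℤ.+ n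
  hit? : ∀ i → Dec (d ≡ m i)
  hit? i = d ℤP.≟ m i
  pointwise : ∀ i → m i * m i * (if does (d ℤP.≟ m i) then c else 0ℤ) ≡ when hit? i (m i * m i * c)
  pointwise i with d ℤP.≟ m i
  ... | yes _ = refl
  ... | no _  = ℤP.*-zeroʳ (m i * m i)
  into : ∀ x → x ∈ [ i₀ ] → x ∈ filter hit? U
  into x (here refl) = MP.∈-filter⁺ hit? (MP.∈-upTo⁺ (s≤s i₀≤)) d≡
  onto : ∀ y → y ∈ filter hit? U → ∃ λ x → x ∈ [ i₀ ] × x ≡ y
  onto y y∈ = i₀ , here refl , index-injective n i₀ y (trans (sym d≡) (proj₂ (MP.∈-filter⁻ hit? {xs = U} y∈)))

Σrange-moment : ∀ {A : Set} n (xs : List A) (d : A → ℤ) (c : A → ℤ) → (∀ x → x ∈ xs → WithinRange n (d x)) →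
  Σrange n (λ m → m * m * Σ∈ (filter (λ x → d x ℤP.≟ m) xs) c) ≡ Σ∈ xs (λ x → d x * d x * c x)
Σrange-moment n xs d c within = begin
  Σrange n (λ m → m * m * Σ∈ (filter (λ x → d x ℤP.≟ m) xs) c)
    ≡⟨ Σ∈-ext (upTo (suc (n ℕ.+ n))) (λ i → cong ((ℤ.+ i - ℤ.+ n) * (ℤ.+ i - ℤ.+ n) *_) (Σ∈-filter _ xs c)) ⟩
  Σrange n (λ m → m * m * Σ∈ xs (λ x → if does (d x ℤP.≟ m) then c x else 0ℤ))
    ≡⟨ Σrange-Σ∈ n xs (λ x m → if does (d x ℤP.≟ m) then c x else 0ℤ) ⟩
  Σ∈ xs (λ x → Σrange n (λ m → m * m * (if does (d x ℤP.≟ m) then c x else 0ℤ)))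
    ≡⟨ Σ∈-cong xs (λ x x∈ → Σrange-point n (d x) (c x) (within x x∈)) ⟩
  Σ∈ xs (λ x → d x * d x * c x) ∎
  where open ≡-Reasoning

Σ-square-difference : ∀ {A B : Set} (xs : List A) (ys : List B) (a : A → ℤ) (b : B → ℤ) →
  Σ∈ xs (λ x → Σ∈ ys (λ y → (a x - b y) * (a x - b y))) ≡
  Σ∈ xs (λ x → a x * a x) * Σ∈ ys (λ _ → 1ℤ) + Σ∈ xs (λ _ → 1ℤ) * Σ∈ ys (λ y → b y * b y)
    - (Σ∈ xs a * Σ∈ ys b + Σ∈ xs a * Σ∈ ys b)
Σ-square-difference xs ys a b = begin
  Σ∈ xs (λ x → Σ∈ ys (λ y → (a x - b y) * (a x - b y)))
    ≡⟨ Σ∈-ext xs (λ x → Σ∈-ext ys (λ y → expand (a x) (b y))) ⟩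
  Σ∈ xs (λ x → Σ∈ ys (λ y → a x * a x * 1ℤ + 1ℤ * (b y * b y) - (a x * b y + a x * b y)))
    ≡⟨ Σ∈-ext xs inner ⟩
  Σ∈ xs (λ x → a x * a x * #ys + 1ℤ * Σb² - (a x * Σb + a x * Σb))
    ≡⟨ trans (Σ∈-linear xs _ _ _) (cong₂ _-_ (cong₂ _+_ (Σ∈-*ʳ xs #ys (λ x → a x * a x)) (Σ∈-*ʳ xs Σb² (λ _ → 1ℤ)))
                                              (cong₂ _+_ (Σ∈-*ʳ xs Σb a) (Σ∈-*ʳ xs Σb a))) ⟩
  Σ∈ xs (λ x → a x * a x) * #ys + Σ∈ xs (λ _ → 1ℤ) * Σb² - (Σ∈ xs a * Σb + Σ∈ xs a * Σb) ∎
  where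
  open ≡-Reasoning
  #ys = Σ∈ ys (λ _ → 1ℤ)
  Σb = Σ∈ ys b
  Σb² = Σ∈ ys (λ y → b y * b y)
  expand : ∀ u v → (u - v) * (u - v) ≡ u * u * 1ℤ + 1ℤ * (v * v) - (u * v + u * v)
  expand = solve-∀
  inner : ∀ x → Σ∈ ys (λ y → a x * a x * 1ℤ + 1ℤ * (b y * b y) - (a x * b y + a x * b y)) ≡
                a x * a x * #ys + 1ℤ * Σb² - (a x * Σb + a x * Σb)
  inner x = trans (Σ∈-linear ys _ _ _)
    (cong₂ _-_ (cong₂ _+_ (Σ∈-*ˡ ys (a x * a x) (λ _ → 1ℤ)) (Σ∈-*ˡ ys 1ℤ _))
               (cong₂ _+_ (Σ∈-*ˡ ys (a x) b) (Σ∈-*ˡ ys (a x) b)))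

-- Generating function of Σ (#π − #π′)² over pairs of partitions with parts ≤ j:
--   PairMoment j = 2 (F₂ F₀ − F₁²)(j), written symmetrically.
PairMoment : ℕ → Ser
PairMoment j = F₂ j ⊛ F₀ j ⊕ F₀ j ⊛ F₂ j ⊖ (F₁ j ⊛ F₁ j ⊕ F₁ j ⊛ F₁ j)

partsGap : List ℕ → List ℕ → ℤ
partsGap π π′ = ℤ.+ #parts π - ℤ.+ #parts π′

⊛-combination : ∀ (Ga Gb Gc Ha Hb Hc : Ser) r →
  Σ≤ r (λ k → Gc k * Ha (r ∸ k) + Ga k * Hc (r ∸ k) - (Gb k * Hb (r ∸ k) + Gb k * Hb (r ∸ k))) ≡
  (Gc ⊛ Ha ⊕ Ga ⊛ Hc ⊖ (Gb ⊛ Hb ⊕ Gb ⊛ Hb)) r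
⊛-combination Ga Gb Gc Ha Hb Hc r =
  trans (Σ∈-linear (upTo (suc r)) (λ k → Gc k * Ha (r ∸ k)) (λ k → Ga k * Hc (r ∸ k)) (λ k → Gb k * Hb (r ∸ k)))
        (sym (cong₂ _-_ (cong₂ _+_ (⊛-as-Σ Gc Ha r) (⊛-as-Σ Ga Hc r)) (cong₂ _+_ (⊛-as-Σ Gb Hb r) (⊛-as-Σ Gb Hb r))))

PairMoment-as-Σ : ∀ N r →
  Σ≤ r (λ k → Σ∈ (boundedPartitions N k) λ π → Σ∈ (boundedPartitions N (r ∸ k)) λ π′ → partsGap π π′ * partsGap π π′)
  ≡ PairMoment N r
PairMoment-as-Σ N r =
  trans (Σ∈-ext (upTo (suc r)) (λ k → Σ-square-difference (boundedPartitions N k) (boundedPartitions N (r ∸ k))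
                                         (λ π → ℤ.+ #parts π) (λ π → ℤ.+ #parts π)))
        (⊛-combination (F₀ N) (F₁ N) (F₂ N) (F₀ N) (F₁ N) (F₂ N) r)

-- Σ rank² over partitions with Durfee square j is q^{j²} PairMoment j: the
-- rank α₁ − #β is a partsGap once the arm α is read as a partition with at
-- most j parts, i.e. (conjugating) one with parts ≤ j.
rankMoment-durfee : ∀ j → 1 ≤ j → ∀ r →
  Σ∈ (filter (hasDurfee? j) (partitions r)) (λ λ′ → rank λ′ * rank λ′) ≡ sh (j ℕ.* j) (PairMoment j) r
rankMoment-durfee j 1≤j r = trans (Σ-durfee j 1≤j (λ λ′ → rank λ′ * rank λ′) r) (sh-cong (j ℕ.* j) legs-and-arms r)
  where
  legs-and-arms : ∀ t → (Σ≤ t λ s → Σ∈ (nonincVecs j s) λ α → Σ∈ (boundedPartitions j (t ∸ s)) λ β →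
                          rank (glue j (α , β)) * rank (glue j (α , β))) ≡ PairMoment j t
  legs-and-arms t = begin
    (Σ≤ t λ s → Σ∈ (nonincVecs j s) λ α → Σ∈ (boundedPartitions j (t ∸ s)) λ β → rank (glue j (α , β)) * rank (glue j (α , β)))
      ≡⟨ Σ∈-ext (upTo (suc t)) (λ s → Σ∈-cong (nonincVecs j s) (λ α α∈ → Σ∈-ext (boundedPartitions j (t ∸ s)) (λ β →
           cong (λ z → z * z) (rank-glue j α β (proj₁ (nonincVecs⁻ j s α α∈)) 1≤j)))) ⟩
    (Σ≤ t λ s → Σ∈ (nonincVecs j s) λ α → Σ∈ (boundedPartitions j (t ∸ s)) λ β → (ℤ.+ largest α - ℤ.+ length β) * (ℤ.+ largest α - ℤ.+ length β))
      ≡⟨ Σ∈-ext (upTo (suc t)) (λ s → Σ-square-difference (nonincVecs j s) (boundedPartitions j (t ∸ s))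
                                          (λ α → ℤ.+ largest α) (λ π → ℤ.+ #parts π)) ⟩
    (Σ≤ t λ s → VecGF j (λ a → ℤ.+ a * ℤ.+ a) s * F₀ j (t ∸ s) + VecGF j (λ _ → 1ℤ) s * F₂ j (t ∸ s)
                - (VecGF j (λ a → ℤ.+ a) s * F₁ j (t ∸ s) + VecGF j (λ a → ℤ.+ a) s * F₁ j (t ∸ s)))
      ≡⟨ Σ∈-ext (upTo (suc t)) (λ s → cong₂ _-_
           (cong₂ _+_ (cong (_* F₀ j (t ∸ s)) (VecGF≡BoundedGF j (λ a → ℤ.+ a * ℤ.+ a) s))
                      (cong (_* F₂ j (t ∸ s)) (VecGF≡BoundedGF j (λ _ → 1ℤ) s)))
           (cong₂ _+_ (cong (_* F₁ j (t ∸ s)) (VecGF≡BoundedGF j ℤ.+_ s))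
                      (cong (_* F₁ j (t ∸ s)) (VecGF≡BoundedGF j ℤ.+_ s)))) ⟩
    (Σ≤ t λ s → F₂ j s * F₀ j (t ∸ s) + F₀ j s * F₂ j (t ∸ s) - (F₁ j s * F₁ j (t ∸ s) + F₁ j s * F₁ j (t ∸ s)))
      ≡⟨ ⊛-combination (F₀ j) (F₁ j) (F₂ j) (F₀ j) (F₁ j) (F₂ j) t ⟩
    PairMoment j t ∎
    where open ≡-Reasoning

#parts≤size : ∀ N m π → π ∈ boundedPartitions N m → #parts π ≤ m
#parts≤size N m π π∈ with ∈-filter-partitions⁻ (bounded? N) m π π∈
... | (_ , pos , s) , _ = subst (length π ≤_) s (length≤sum π pos)

upTo-bound : ∀ {n k} → k ∈ upTo (suc n) → k ≤ n
upTo-bound k∈ = ℕP.≤-pred (MP.∈-upTo⁻ k∈)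

distinctBounded : ℕ → ℕ → List (List ℕ)
distinctBounded N k = filter (λ π → distinct? π ×-dec bounded? N π) (partitions k)

-- Their signed count is (q;q)_N, as they are the distinct partitions with parts in [1, N].
distinctBounded-signed : ∀ N k → Σ∈ (distinctBounded N k) (λ π → sign (#parts π)) ≡ qProd 1 N k
distinctBounded-signed N k =
  trans (Σ∈-filter-equiv (partitions k) _ (inRange? 1 N) _ same) (signedDistinct≈qProd 1 N k)
  where
  same : ∀ x → x ∈ partitions k → (Distinct x × Bounded N x → InRange 1 N x) × (InRange 1 N x → Distinct x × Bounded N x)
  same x x∈ with partitions⁻ k x x∈
  ... | _ , pos , _ = (λ { (d , b) → d , All.zipWith (λ { (p , q) → p , q }) (pos , b) }) ,
                      (λ { (d , b) → d , All.map proj₂ b })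

-- Unfolding M₂: the m-sum collapses onto the value m = #π₂ − #π₃.
M2-expand : ∀ N n → M2 N n ≡
  (Σ≤ n λ k₁ → Σ≤ (n ∸ k₁) λ k₂ → Σ∈ (distinctBounded N k₁) λ π₁ → Σ∈ (boundedPartitions N k₂) λ π₂ →
     Σ∈ (boundedPartitions N (n ∸ k₁ ∸ k₂)) λ π₃ → partsGap π₂ π₃ * partsGap π₂ π₃ * sign (#parts π₁))
M2-expand N n =
  trans (Σrange-Σ∈ n (upTo (suc n)) (λ k₁ m → Σ≤ (n ∸ k₁) λ k₂ → Σ∈ (distinctBounded N k₁) λ π₁ →
                                       Σ∈ (boundedPartitions N k₂) λ π₂ → fixedGap m k₁ k₂ π₁ π₂))
        (Σ∈-cong (upTo (suc n)) λ k₁ _ →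
  trans (Σrange-Σ∈ n (upTo (suc (n ∸ k₁))) (λ k₂ m → Σ∈ (distinctBounded N k₁) λ π₁ →
                                              Σ∈ (boundedPartitions N k₂) λ π₂ → fixedGap m k₁ k₂ π₁ π₂))
        (Σ∈-cong (upTo (suc (n ∸ k₁))) λ k₂ k₂∈ →
  trans (Σrange-Σ∈ n (distinctBounded N k₁) (λ π₁ m → Σ∈ (boundedPartitions N k₂) λ π₂ → fixedGap m k₁ k₂ π₁ π₂))
        (Σ∈-ext (distinctBounded N k₁) λ π₁ →
  trans (Σrange-Σ∈ n (boundedPartitions N k₂) (λ π₂ m → fixedGap m k₁ k₂ π₁ π₂))
        (Σ∈-cong (boundedPartitions N k₂) λ π₂ π₂∈ →
  Σrange-moment n (boundedPartitions N (n ∸ k₁ ∸ k₂)) (partsGap π₂) (λ _ → sign (#parts π₁))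
                (λ π₃ π₃∈ → gap-within k₁ k₂ π₂ π₃ k₂∈ π₂∈ π₃∈)))))
  where
  fixedGap : ℤ → ℕ → ℕ → List ℕ → List ℕ → ℤ
  fixedGap m k₁ k₂ π₁ π₂ =
    Σ∈ (filter (λ π₃ → partsGap π₂ π₃ ℤP.≟ m) (boundedPartitions N (n ∸ k₁ ∸ k₂))) (λ _ → sign (#parts π₁))
  -- Both π₂ and π₃ have at most n parts.
  gap-within : ∀ k₁ k₂ π₂ π₃ → k₂ ∈ upTo (suc (n ∸ k₁)) → π₂ ∈ boundedPartitions N k₂ →
               π₃ ∈ boundedPartitions N (n ∸ k₁ ∸ k₂) → WithinRange n (partsGap π₂ π₃)
  gap-within k₁ k₂ π₂ π₃ k₂∈ π₂∈ π₃∈ = difference-within n (#parts π₂) (#parts π₃)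
    (ℕP.≤-trans (#parts≤size N k₂ π₂ π₂∈) (ℕP.≤-trans (upTo-bound k₂∈) (ℕP.m∸n≤m n k₁)))
    (ℕP.≤-trans (#parts≤size N _ π₃ π₃∈) (ℕP.≤-trans (ℕP.m∸n≤m (n ∸ k₁) k₂) (ℕP.m∸n≤m n k₁)))

M2-series : ∀ N n → M2 N n ≡ (qProd 1 N ⊛ PairMoment N) n
M2-series N n = trans (M2-expand N n) (trans (Σ∈-ext (upTo (suc n)) factor) (sym (⊛-as-Σ (qProd 1 N) (PairMoment N) n)))
  where
  factor : ∀ k₁ → (Σ≤ (n ∸ k₁) λ k₂ → Σ∈ (distinctBounded N k₁) λ π₁ → Σ∈ (boundedPartitions N k₂) λ π₂ →
                     Σ∈ (boundedPartitions N (n ∸ k₁ ∸ k₂)) λ π₃ → partsGap π₂ π₃ * partsGap π₂ π₃ * sign (#parts π₁))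
                  ≡ qProd 1 N k₁ * PairMoment N (n ∸ k₁)
  factor k₁ = begin
    _ ≡⟨ Σ∈-swap (upTo (suc (n ∸ k₁))) (distinctBounded N k₁) (λ k₂ π₁ → Σ∈ (boundedPartitions N k₂) λ π₂ →
           Σ∈ (boundedPartitions N (n ∸ k₁ ∸ k₂)) λ π₃ → gap² π₂ π₃ * sign (#parts π₁)) ⟩
    (Σ∈ (distinctBounded N k₁) λ π₁ → Σ≤ (n ∸ k₁) λ k₂ → Σ∈ (boundedPartitions N k₂) λ π₂ →
       Σ∈ (boundedPartitions N (n ∸ k₁ ∸ k₂)) λ π₃ → gap² π₂ π₃ * sign (#parts π₁))
      ≡⟨ Σ∈-ext (distinctBounded N k₁) (λ π₁ → trans (pull-sign (sign (#parts π₁))) (cong (_* sign (#parts π₁)) (PairMoment-as-Σ N (n ∸ k₁)))) ⟩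
    (Σ∈ (distinctBounded N k₁) λ π₁ → PairMoment N (n ∸ k₁) * sign (#parts π₁))
      ≡⟨ Σ∈-*ˡ (distinctBounded N k₁) (PairMoment N (n ∸ k₁)) (λ π₁ → sign (#parts π₁)) ⟩
    PairMoment N (n ∸ k₁) * Σ∈ (distinctBounded N k₁) (λ π₁ → sign (#parts π₁))
      ≡⟨ trans (cong (PairMoment N (n ∸ k₁) *_) (distinctBounded-signed N k₁)) (ℤP.*-comm (PairMoment N (n ∸ k₁)) (qProd 1 N k₁)) ⟩
    qProd 1 N k₁ * PairMoment N (n ∸ k₁) ∎
    where
    open ≡-Reasoning
    gap² : List ℕ → List ℕ → ℤ
    gap² π₂ π₃ = partsGap π₂ π₃ * partsGap π₂ π₃
    pull-sign : ∀ c → (Σ≤ (n ∸ k₁) λ k₂ → Σ∈ (boundedPartitions N k₂) λ π₂ → Σ∈ (boundedPartitions N (n ∸ k₁ ∸ k₂)) λ π₃ → gap² π₂ π₃ * c)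
                      ≡ (Σ≤ (n ∸ k₁) λ k₂ → Σ∈ (boundedPartitions N k₂) λ π₂ → Σ∈ (boundedPartitions N (n ∸ k₁ ∸ k₂)) λ π₃ → gap² π₂ π₃) * c
    pull-sign c = trans (Σ∈-ext (upTo (suc (n ∸ k₁))) (λ k₂ →
                    trans (Σ∈-ext (boundedPartitions N k₂) (λ π₂ → Σ∈-*ʳ (boundedPartitions N (n ∸ k₁ ∸ k₂)) c (gap² π₂)))
                          (Σ∈-*ʳ (boundedPartitions N k₂) c (λ π₂ → Σ∈ (boundedPartitions N (n ∸ k₁ ∸ k₂)) (gap² π₂)))))
                  (Σ∈-*ʳ (upTo (suc (n ∸ k₁))) c (λ k₂ → Σ∈ (boundedPartitions N k₂) λ π₂ →
                                                          Σ∈ (boundedPartitions N (n ∸ k₁ ∸ k₂)) (gap² π₂)))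

N2-term : ∀ N j n → 1 ≤ j → Σrange n (λ m → m * m * NS1-j N j m n) ≡ (qProd (suc (N ∸ j)) N ⊛ sh (j ℕ.* j) (PairMoment j)) n
N2-term N j n 1≤j = begin
  Σrange n (λ m → m * m * NS1-j N j m n)
    ≡⟨ Σrange-Σ∈ n (upTo (suc n)) (λ k m → Σ∈ (arms k) λ π₁ → fixedRank m k π₁) ⟩
  (Σ≤ n λ k → Σrange n (λ m → m * m * Σ∈ (arms k) λ π₁ → fixedRank m k π₁))
    ≡⟨ Σ∈-ext (upTo (suc n)) (λ k → trans (Σrange-Σ∈ n (arms k) (λ π₁ m → fixedRank m k π₁))
                                          (Σ∈-ext (arms k) (λ π₁ → collapse k π₁))) ⟩
  (Σ≤ n λ k → Σ∈ (arms k) λ π₁ → sh (j ℕ.* j) (PairMoment j) (n ∸ k) * sign (#parts π₁))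
    ≡⟨ Σ∈-ext (upTo (suc n)) (λ k → trans (Σ∈-*ˡ (arms k) (sh (j ℕ.* j) (PairMoment j) (n ∸ k)) (λ π₁ → sign (#parts π₁)))
                                          (trans (cong (sh (j ℕ.* j) (PairMoment j) (n ∸ k) *_) (signedDistinct≈qProd (suc (N ∸ j)) N k))
                                                 (ℤP.*-comm _ (qProd (suc (N ∸ j)) N k)))) ⟩
  (Σ≤ n λ k → qProd (suc (N ∸ j)) N k * sh (j ℕ.* j) (PairMoment j) (n ∸ k))
    ≡⟨ sym (⊛-as-Σ (qProd (suc (N ∸ j)) N) (sh (j ℕ.* j) (PairMoment j)) n) ⟩
  (qProd (suc (N ∸ j)) N ⊛ sh (j ℕ.* j) (PairMoment j)) n ∎
  where
  open ≡-Reasoning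
  arms : ℕ → List (List ℕ)
  arms k = filter (S1-π₁? N j) (partitions k)
  durfeeJ : ℕ → List (List ℕ)
  durfeeJ k = filter (hasDurfee? j) (partitions (n ∸ k))
  fixedRank : ℤ → ℕ → List ℕ → ℤ
  fixedRank m k π₁ =
    Σ∈ (filter (λ π₂ → (durfee π₂ ℕP.≟ j) ×-dec (rank π₂ ℤP.≟ m)) (partitions (n ∸ k))) (λ _ → sign (#parts π₁))
  rank-within : ∀ k x → x ∈ durfeeJ k → WithinRange n (rank x)
  rank-within k x x∈ with ∈-filter-partitions⁻ (hasDurfee? j) (n ∸ k) x x∈
  ... | (_ , pos , s) , _ = difference-within n (largest x) (#parts x)
        (ℕP.≤-trans (ℕP.≤-trans (largest≤sum x) (ℕP.≤-reflexive s)) (ℕP.m∸n≤m n k))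
        (ℕP.≤-trans (ℕP.≤-trans (length≤sum x pos) (ℕP.≤-reflexive s)) (ℕP.m∸n≤m n k))
  collapse : ∀ k π₁ → Σrange n (λ m → m * m * fixedRank m k π₁) ≡ sh (j ℕ.* j) (PairMoment j) (n ∸ k) * sign (#parts π₁)
  collapse k π₁ = begin
    Σrange n (λ m → m * m * fixedRank m k π₁)
      ≡⟨ Σ∈-ext (upTo (suc (n ℕ.+ n))) (λ i → cong ((ℤ.+ i - ℤ.+ n) * (ℤ.+ i - ℤ.+ n) *_)
           (Σ∈-filter-× (hasDurfee? j) (λ π₂ → rank π₂ ℤP.≟ (ℤ.+ i - ℤ.+ n)) (partitions (n ∸ k)) (λ _ → sign (#parts π₁)))) ⟩
    Σrange n (λ m → m * m * Σ∈ (filter (λ π₂ → rank π₂ ℤP.≟ m) (durfeeJ k)) (λ _ → sign (#parts π₁)))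
      ≡⟨ Σrange-moment n (durfeeJ k) rank (λ _ → sign (#parts π₁)) (rank-within k) ⟩
    Σ∈ (durfeeJ k) (λ π₂ → rank π₂ * rank π₂ * sign (#parts π₁))
      ≡⟨ Σ∈-*ʳ (durfeeJ k) (sign (#parts π₁)) (λ π₂ → rank π₂ * rank π₂) ⟩
    Σ∈ (durfeeJ k) (λ π₂ → rank π₂ * rank π₂) * sign (#parts π₁)
      ≡⟨ cong (_* sign (#parts π₁)) (rankMoment-durfee j 1≤j (n ∸ k)) ⟩
    sh (j ℕ.* j) (PairMoment j) (n ∸ k) * sign (#parts π₁) ∎

squareSizes : ℕ → List ℕ
squareSizes N = map suc (upTo N)

squareSizes-bounds : ∀ N j → j ∈ squareSizes N → 1 ≤ j × j ≤ N
squareSizes-bounds N j j∈ with MP.∈-map⁻ suc j∈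
... | i , i∈ , refl = s≤s z≤n , MP.∈-upTo⁻ i∈

N2-series : ∀ N n → N2 N n ≡ Σ∈ (squareSizes N) (λ j → (qProd (suc (N ∸ j)) N ⊛ sh (j ℕ.* j) (PairMoment j)) n)
N2-series N n = trans (Σrange-Σ∈ n (squareSizes N) (λ j m → NS1-j N j m n))
                      (Σ∈-cong (squareSizes N) (λ j j∈ → N2-term N j n (proj₁ (squareSizes-bounds N j j∈))))

move-right : ∀ {a b} c → a ≋ b ⊕ c → b ≋ a ⊖ c
move-right {a} {b} c e = ≋-trans (cancel b c) (⊖-congˡ≋ c (≋-sym e))
  where
  cancel : ∀ b c → b ≋ b ⊕ c ⊖ c
  cancel = solve 2 (λ b c → b := b :+ c :- c) ≋-refl

F₀-down : ∀ j → F₀ j ≋ F₀ (suc j) ⊖ X (suc j) ⊛ F₀ (suc j)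
F₀-down j = move-right _ (F₀-suc j)

F₁-down : ∀ j → F₁ j ≋ F₁ (suc j) ⊖ X (suc j) ⊛ (F₁ (suc j) ⊕ F₀ (suc j))
F₁-down j = move-right _ (F₁-suc j)

F₂-down : ∀ j → F₂ j ≋ F₂ (suc j) ⊖ X (suc j) ⊛ (F₂ (suc j) ⊕ (F₁ (suc j) ⊕ F₁ (suc j)) ⊕ F₀ (suc j))
F₂-down j = move-right _ (F₂-suc j)

oneMinusX-F₀ : ∀ j → oneMinusX (suc j) ⊛ F₀ (suc j) ≋ F₀ j
oneMinusX-F₀ j = begin
  oneMinusX (suc j) ⊛ F₀ (suc j)        ≈⟨ ⊛-congˡ≋ (F₀ (suc j)) (oneMinusX≋ (suc j)) ⟩
  (const 1ℤ ⊖ X (suc j)) ⊛ F₀ (suc j)   ≈⟨ distribute (F₀ (suc j)) (X (suc j)) ⟩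
  F₀ (suc j) ⊖ X (suc j) ⊛ F₀ (suc j)   ≈⟨ ≋-sym (F₀-down j) ⟩
  F₀ j                                  ∎
  where
  open ≋-Reasoning
  distribute : ∀ p x → (const 1ℤ ⊖ x) ⊛ p ≋ p ⊖ x ⊛ p
  distribute = solve 2 (λ p x → (con 1ℤ :- x) :* p := p :- x :* p) ≋-refl

Poch : ℕ → Ser
Poch j = qProd 1 j

Poch-F₀ : ∀ j → Poch j ⊛ F₀ j ≋ δ
Poch-F₀ zero    = ≋-trans (mk≋ (⊛-identityˡ (F₀ 0))) F₀-zero
Poch-F₀ (suc j) = begin
  Poch (suc j) ⊛ F₀ (suc j)                    ≈⟨ ⊛-congˡ≋ (F₀ (suc j)) (qProd-suc 1 j (s≤s z≤n)) ⟩
  oneMinusX (suc j) ⊛ Poch j ⊛ F₀ (suc j)      ≈⟨ exchange (oneMinusX (suc j)) (Poch j) (F₀ (suc j)) ⟩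
  Poch j ⊛ (oneMinusX (suc j) ⊛ F₀ (suc j))    ≈⟨ ⊛-congʳ≋ (Poch j) (oneMinusX-F₀ j) ⟩
  Poch j ⊛ F₀ j                                ≈⟨ Poch-F₀ j ⟩
  δ                                            ∎
  where
  open ≋-Reasoning
  exchange : ∀ a b c → a ⊛ b ⊛ c ≋ b ⊛ (a ⊛ c)
  exchange = solve 3 (λ a b c → a :* b :* c := b :* (a :* c)) ≋-refl

Var : ℕ → Ser
Var j = F₂ j ⊛ F₀ j ⊖ F₁ j ⊛ F₁ j

PairMoment≋Var : ∀ j → PairMoment j ≋ Var j ⊕ Var j
PairMoment≋Var j = symmetrise (F₂ j) (F₀ j) (F₁ j)
  where
  symmetrise : ∀ a b c → a ⊛ b ⊕ b ⊛ a ⊖ (c ⊛ c ⊕ c ⊛ c) ≋ (a ⊛ b ⊖ c ⊛ c) ⊕ (a ⊛ b ⊖ c ⊛ c)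
  symmetrise = solve 3 (λ a b c → a :* b :+ b :* a :- (c :* c :+ c :* c) := (a :* b :- c :* c) :+ (a :* b :- c :* c)) ≋-refl

Var-step : ∀ j → oneMinusX (suc j) ⊛ oneMinusX (suc j) ⊛ Var (suc j) ≋ Var j ⊕ X (suc j) ⊛ F₀ (suc j) ⊛ F₀ (suc j)
Var-step j = begin
  oneMinusX (suc j) ⊛ oneMinusX (suc j) ⊛ Var (suc j)
    ≈⟨ ⊛-congˡ≋ (Var (suc j)) (⊛-cong (oneMinusX≋ (suc j)) (oneMinusX≋ (suc j))) ⟩
  (const 1ℤ ⊖ x) ⊛ (const 1ℤ ⊖ x) ⊛ (b ⊛ p ⊖ a ⊛ a)
    ≈⟨ expand b a p x ⟩
  (b ⊖ x ⊛ (b ⊕ (a ⊕ a) ⊕ p)) ⊛ (p ⊖ x ⊛ p) ⊖ (a ⊖ x ⊛ (a ⊕ p)) ⊛ (a ⊖ x ⊛ (a ⊕ p)) ⊕ x ⊛ p ⊛ p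
    ≈⟨ ⊕-congˡ≋ (x ⊛ p ⊛ p) (⊖-cong (⊛-cong (≋-sym (F₂-down j)) (≋-sym (F₀-down j)))
                                    (⊛-cong (≋-sym (F₁-down j)) (≋-sym (F₁-down j)))) ⟩
  Var j ⊕ x ⊛ p ⊛ p ∎
  where
  open ≋-Reasoning
  x = X (suc j)
  p = F₀ (suc j)
  a = F₁ (suc j)
  b = F₂ (suc j)
  expand : ∀ b a p x → (const 1ℤ ⊖ x) ⊛ (const 1ℤ ⊖ x) ⊛ (b ⊛ p ⊖ a ⊛ a) ≋
           (b ⊖ x ⊛ (b ⊕ (a ⊕ a) ⊕ p)) ⊛ (p ⊖ x ⊛ p) ⊖ (a ⊖ x ⊛ (a ⊕ p)) ⊛ (a ⊖ x ⊛ (a ⊕ p)) ⊕ x ⊛ p ⊛ p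
  expand = solve 4 (λ b a p x → (con 1ℤ :- x) :* (con 1ℤ :- x) :* (b :* p :- a :* a) :=
             (b :- x :* (b :+ (a :+ a) :+ p)) :* (p :- x :* p) :- (a :- x :* (a :+ p)) :* (a :- x :* (a :+ p)) :+ x :* p :* p)
             ≋-refl

-- Geom j = (q;q)_j F₀ (j+1) = 1/(1 − q^{j+1}).
Geom : ℕ → Ser
Geom j = Poch j ⊛ F₀ (suc j)

Geom-inverse : ∀ j → oneMinusX (suc j) ⊛ Geom j ≋ const 1ℤ
Geom-inverse j = begin
  oneMinusX (suc j) ⊛ (Poch j ⊛ F₀ (suc j))  ≈⟨ exchange (oneMinusX (suc j)) (Poch j) (F₀ (suc j)) ⟩
  Poch j ⊛ (oneMinusX (suc j) ⊛ F₀ (suc j))  ≈⟨ ⊛-congʳ≋ (Poch j) (oneMinusX-F₀ j) ⟩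
  Poch j ⊛ F₀ j                              ≈⟨ Poch-F₀ j ⟩
  δ                                          ≈⟨ ≋-sym const-one ⟩
  const 1ℤ                                   ∎
  where
  open ≋-Reasoning
  exchange : ∀ a b c → a ⊛ (b ⊛ c) ≋ b ⊛ (a ⊛ c)
  exchange = solve 3 (λ a b c → a :* (b :* c) := b :* (a :* c)) ≋-refl

-- Lambert j = Σ_{i=1}^{j} q^i/(1 − q^i)².
Lambert : ℕ → Ser
Lambert zero    = 𝟘
Lambert (suc j) = Lambert j ⊕ X (suc j) ⊛ (Geom j ⊛ Geom j)

Var≋ : ∀ j → Var j ≋ F₀ j ⊛ F₀ j ⊛ Lambert j
Var≋ zero = begin
  F₂ 0 ⊛ F₀ 0 ⊖ F₁ 0 ⊛ F₁ 0
    ≈⟨ ⊖-cong (⊛-congˡ≋ (F₀ 0) (≋-trans F₂-zero (≋-sym const-zero)))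
              (⊛-cong (≋-trans F₁-zero (≋-sym const-zero)) (≋-trans F₁-zero (≋-sym const-zero))) ⟩
  const 0ℤ ⊛ F₀ 0 ⊖ const 0ℤ ⊛ const 0ℤ      ≈⟨ vanish (F₀ 0) ⟩
  F₀ 0 ⊛ F₀ 0 ⊛ const 0ℤ                    ≈⟨ ⊛-congʳ≋ (F₀ 0 ⊛ F₀ 0) const-zero ⟩
  F₀ 0 ⊛ F₀ 0 ⊛ 𝟘                           ∎
  where
  open ≋-Reasoning
  vanish : ∀ p → const 0ℤ ⊛ p ⊖ const 0ℤ ⊛ const 0ℤ ≋ p ⊛ p ⊛ const 0ℤ
  vanish = solve 1 (λ p → con 0ℤ :* p :- con 0ℤ :* con 0ℤ := p :* p :* con 0ℤ) ≋-refl
Var≋ (suc j) = begin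
  Var (suc j)                                       ≈⟨ insert-one (Var (suc j)) ⟩
  const 1ℤ ⊛ const 1ℤ ⊛ Var (suc j)                 ≈⟨ ⊛-congˡ≋ (Var (suc j)) (⊛-cong (≋-sym (Geom-inverse j)) (≋-sym (Geom-inverse j))) ⟩
  (y ⊛ h) ⊛ (y ⊛ h) ⊛ Var (suc j)                   ≈⟨ regroup₁ y h (Var (suc j)) ⟩
  h ⊛ h ⊛ (y ⊛ y ⊛ Var (suc j))                     ≈⟨ ⊛-congʳ≋ (h ⊛ h) (Var-step j) ⟩
  h ⊛ h ⊛ (Var j ⊕ x ⊛ p ⊛ p)                       ≈⟨ ⊛-congʳ≋ (h ⊛ h) (⊕-congˡ≋ (x ⊛ p ⊛ p) (Var≋ j)) ⟩
  h ⊛ h ⊛ (F₀ j ⊛ F₀ j ⊛ Lambert j ⊕ x ⊛ p ⊛ p)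
    ≈⟨ ⊛-congʳ≋ (h ⊛ h) (⊕-congˡ≋ (x ⊛ p ⊛ p) (⊛-congˡ≋ (Lambert j) (⊛-cong (≋-sym (oneMinusX-F₀ j)) (≋-sym (oneMinusX-F₀ j))))) ⟩
  h ⊛ h ⊛ ((y ⊛ p) ⊛ (y ⊛ p) ⊛ Lambert j ⊕ x ⊛ p ⊛ p) ≈⟨ regroup₂ h y p (Lambert j) x ⟩
  (y ⊛ h) ⊛ (y ⊛ h) ⊛ p ⊛ p ⊛ Lambert j ⊕ x ⊛ p ⊛ p ⊛ (h ⊛ h)
    ≈⟨ ⊕-congˡ≋ (x ⊛ p ⊛ p ⊛ (h ⊛ h)) (⊛-congˡ≋ (Lambert j) (⊛-congˡ≋ p (⊛-congˡ≋ p (⊛-cong (Geom-inverse j) (Geom-inverse j))))) ⟩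
  const 1ℤ ⊛ const 1ℤ ⊛ p ⊛ p ⊛ Lambert j ⊕ x ⊛ p ⊛ p ⊛ (h ⊛ h) ≈⟨ regroup₃ p (Lambert j) x (h ⊛ h) ⟩
  p ⊛ p ⊛ (Lambert j ⊕ x ⊛ (h ⊛ h))                 ∎
  where
  open ≋-Reasoning
  x = X (suc j)
  p = F₀ (suc j)
  h = Geom j
  y = oneMinusX (suc j)
  insert-one : ∀ v → v ≋ const 1ℤ ⊛ const 1ℤ ⊛ v
  insert-one = solve 1 (λ v → v := con 1ℤ :* con 1ℤ :* v) ≋-refl
  regroup₁ : ∀ a b v → (a ⊛ b) ⊛ (a ⊛ b) ⊛ v ≋ b ⊛ b ⊛ (a ⊛ a ⊛ v)
  regroup₁ = solve 3 (λ a b v → (a :* b) :* (a :* b) :* v := b :* b :* (a :* a :* v)) ≋-refl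
  regroup₂ : ∀ h a p s x → h ⊛ h ⊛ ((a ⊛ p) ⊛ (a ⊛ p) ⊛ s ⊕ x ⊛ p ⊛ p) ≋ (a ⊛ h) ⊛ (a ⊛ h) ⊛ p ⊛ p ⊛ s ⊕ x ⊛ p ⊛ p ⊛ (h ⊛ h)
  regroup₂ = solve 5 (λ h a p s x → h :* h :* ((a :* p) :* (a :* p) :* s :+ x :* p :* p) :=
                                    (a :* h) :* (a :* h) :* p :* p :* s :+ x :* p :* p :* (h :* h)) ≋-refl
  regroup₃ : ∀ p s x g → const 1ℤ ⊛ const 1ℤ ⊛ p ⊛ p ⊛ s ⊕ x ⊛ p ⊛ p ⊛ g ≋ p ⊛ p ⊛ (s ⊕ x ⊛ g)
  regroup₃ = solve 4 (λ p s x g → con 1ℤ :* con 1ℤ :* p :* p :* s :+ x :* p :* p :* g := p :* p :* (s :+ x :* g)) ≋-refl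

-- With topProd N j = (q^{N−j+1};q)_j we show
-- topProd N j · F₀ j = Gauss N j, the q-binomial coefficient [N, j] given by
-- the q-Pascal recursion, which visibly has nonnegative coefficients.

qProd-empty : ∀ L U → U ℕ.< L → qProd L U ≋ δ
qProd-empty L zero    _  = ≋-refl
qProd-empty L (suc U) lt = ≋-trans (qProd-skip L U (ℕP.<⇒≱ lt)) (qProd-empty L U (ℕP.<-trans (ℕP.n<1+n U) lt))

qProd-bottom : ∀ L U → 1 ≤ L → L ≤ U → qProd L U ≋ oneMinusX L ⊛ qProd (suc L) U
qProd-bottom L zero    1≤L L≤0 = ⊥-elim (ℕP.<⇒≱ 1≤L L≤0)
qProd-bottom L (suc U) 1≤L L≤U+1 with L ℕP.≟ suc U
... | yes refl = begin
  qProd (suc U) (suc U)                    ≈⟨ qProd-suc (suc U) U ℕP.≤-refl ⟩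
  oneMinusX (suc U) ⊛ qProd (suc U) U      ≈⟨ ⊛-congʳ≋ (oneMinusX (suc U)) (qProd-empty (suc U) U (ℕP.n<1+n U)) ⟩
  oneMinusX (suc U) ⊛ δ                    ≈⟨ ⊛-congʳ≋ (oneMinusX (suc U)) (≋-sym (qProd-empty (suc (suc U)) (suc U) (ℕP.n<1+n (suc U)))) ⟩
  oneMinusX (suc U) ⊛ qProd (suc (suc U)) (suc U) ∎
  where open ≋-Reasoning
... | no L≢ = begin
  qProd L (suc U)                                  ≈⟨ qProd-suc L U L≤U+1 ⟩
  oneMinusX (suc U) ⊛ qProd L U                    ≈⟨ ⊛-congʳ≋ (oneMinusX (suc U)) (qProd-bottom L U 1≤L L≤U) ⟩
  oneMinusX (suc U) ⊛ (oneMinusX L ⊛ qProd (suc L) U) ≈⟨ exchange (oneMinusX (suc U)) (oneMinusX L) (qProd (suc L) U) ⟩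
  oneMinusX L ⊛ (oneMinusX (suc U) ⊛ qProd (suc L) U) ≈⟨ ⊛-congʳ≋ (oneMinusX L) (≋-sym (qProd-suc (suc L) U (s≤s L≤U))) ⟩
  oneMinusX L ⊛ qProd (suc L) (suc U)              ∎
  where
  open ≋-Reasoning
  L≤U : L ≤ U
  L≤U = ℕP.≤-pred (ℕP.≤∧≢⇒< L≤U+1 L≢)
  exchange : ∀ a b c → a ⊛ (b ⊛ c) ≋ b ⊛ (a ⊛ c)
  exchange = solve 3 (λ a b c → a :* (b :* c) := b :* (a :* c)) ≋-refl

topProd : ℕ → ℕ → Ser
topProd N j = qProd (suc (N ∸ j)) N

topProd-top : ∀ N j → j ≤ N → topProd (suc N) (suc j) ≋ oneMinusX (suc N) ⊛ topProd N j
topProd-top N j le = qProd-suc (suc (N ∸ j)) N (s≤s (ℕP.m∸n≤m N j))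

topProd-bottom : ∀ N j → j ℕ.< N → topProd N (suc j) ≋ oneMinusX (N ∸ j) ⊛ topProd N j
topProd-bottom N j lt =
  ≋-trans (qProd-bottom (suc (N ∸ suc j)) N (s≤s z≤n) (subst (_≤ N) (sym e) (ℕP.m∸n≤m N j)))
          (subst (λ z → oneMinusX (suc (N ∸ suc j)) ⊛ qProd (suc (suc (N ∸ suc j))) N ≋ oneMinusX z ⊛ qProd (suc z) N) e ≋-refl)
  where
  e : suc (N ∸ suc j) ≡ N ∸ j
  e = sym (ℕP.+-∸-assoc 1 lt)

topProd-zero : ∀ N → topProd N 0 ≋ δ
topProd-zero N = qProd-empty (suc N) N (ℕP.n<1+n N)

Gauss : ℕ → ℕ → Ser
Gauss N       zero    = δ
Gauss zero    (suc j) = 𝟘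
Gauss (suc N) (suc j) = Gauss N (suc j) ⊕ X (N ∸ j) ⊛ Gauss N j

Gauss-vanish : ∀ N j → N ℕ.< j → Gauss N j ≋ 𝟘
Gauss-vanish zero    (suc j) _        = ≋-refl
Gauss-vanish (suc N) (suc j) (s≤s lt) = begin
  Gauss N (suc j) ⊕ X (N ∸ j) ⊛ Gauss N j
    ≈⟨ ⊕-cong (Gauss-vanish N (suc j) (ℕP.<-trans lt (ℕP.n<1+n j))) (⊛-congʳ≋ (X (N ∸ j)) (Gauss-vanish N j lt)) ⟩
  𝟘 ⊕ X (N ∸ j) ⊛ 𝟘  ≈⟨ absorb (X (N ∸ j)) ⟩
  𝟘                  ∎
  where
  open ≋-Reasoning
  absorb : ∀ x → 𝟘 ⊕ x ⊛ 𝟘 ≋ 𝟘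
  absorb x = ≋-trans (⊕-cong (≋-sym const-zero) (⊛-congʳ≋ x (≋-sym const-zero)))
                     (≋-trans (solve 1 (λ x → con 0ℤ :+ x :* con 0ℤ := con 0ℤ) ≋-refl x) const-zero)

Poch-Gauss : ∀ N j → j ≤ N → Poch j ⊛ Gauss N j ≋ topProd N j
Poch-Gauss N       zero    _  = ≋-trans (mk≋ (⊛-identityˡ δ)) (≋-sym (topProd-zero N))
Poch-Gauss (suc N) (suc j) (s≤s j≤N) with j ℕP.≟ N
... | yes refl = begin
  Poch (suc j) ⊛ (Gauss j (suc j) ⊕ X (j ∸ j) ⊛ Gauss j j)
    ≈⟨ ⊛-cong (qProd-suc 1 j (s≤s z≤n)) (⊕-cong (≋-trans (Gauss-vanish j (suc j) (ℕP.n<1+n j)) (≋-sym const-zero))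
                                                 (⊛-congˡ≋ (Gauss j j) X-diag)) ⟩
  oneMinusX (suc j) ⊛ Poch j ⊛ (const 0ℤ ⊕ const 1ℤ ⊛ Gauss j j) ≈⟨ simplify (oneMinusX (suc j)) (Poch j) (Gauss j j) ⟩
  oneMinusX (suc j) ⊛ (Poch j ⊛ Gauss j j)                       ≈⟨ ⊛-congʳ≋ (oneMinusX (suc j)) (Poch-Gauss j j ℕP.≤-refl) ⟩
  oneMinusX (suc j) ⊛ topProd j j                                ≈⟨ ≋-sym (topProd-top j j ℕP.≤-refl) ⟩
  topProd (suc j) (suc j)                                        ∎
  where
  open ≋-Reasoning
  X-diag : X (j ∸ j) ≋ const 1ℤ
  X-diag = ≋-trans (X-cong (ℕP.n∸n≡0 j)) (≋-trans X-zero (≋-sym const-one))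
  simplify : ∀ a b d → a ⊛ b ⊛ (const 0ℤ ⊕ const 1ℤ ⊛ d) ≋ a ⊛ (b ⊛ d)
  simplify = solve 3 (λ a b d → a :* b :* (con 0ℤ :+ con 1ℤ :* d) := a :* (b :* d)) ≋-refl
... | no j≢N = begin
  Poch (suc j) ⊛ (Gauss N (suc j) ⊕ X a ⊛ Gauss N j)
    ≈⟨ distribute (Poch (suc j)) (Gauss N (suc j)) (X a) (Gauss N j) ⟩
  Poch (suc j) ⊛ Gauss N (suc j) ⊕ X a ⊛ (Poch (suc j) ⊛ Gauss N j)
    ≈⟨ ⊕-cong (Poch-Gauss N (suc j) j<N) (⊛-congʳ≋ (X a) (⊛-congˡ≋ (Gauss N j) (qProd-suc 1 j (s≤s z≤n)))) ⟩
  topProd N (suc j) ⊕ X a ⊛ (oneMinusX (suc j) ⊛ Poch j ⊛ Gauss N j)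
    ≈⟨ ⊕-cong (topProd-bottom N j j<N) (⊛-congʳ≋ (X a) (reassoc (oneMinusX (suc j)) (Poch j) (Gauss N j))) ⟩
  oneMinusX a ⊛ topProd N j ⊕ X a ⊛ (oneMinusX (suc j) ⊛ (Poch j ⊛ Gauss N j))
    ≈⟨ ⊕-cong (⊛-congˡ≋ (topProd N j) (oneMinusX≋ a))
              (⊛-congʳ≋ (X a) (⊛-cong (oneMinusX≋ (suc j)) (Poch-Gauss N j j≤N))) ⟩
  (const 1ℤ ⊖ X a) ⊛ topProd N j ⊕ X a ⊛ ((const 1ℤ ⊖ X (suc j)) ⊛ topProd N j)
    ≈⟨ telescope (X a) (X (suc j)) (topProd N j) ⟩
  (const 1ℤ ⊖ X a ⊛ X (suc j)) ⊛ topProd N j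
    ≈⟨ ⊛-congˡ≋ (topProd N j) (⊖-cong (≋-refl {const 1ℤ}) (≋-trans (X-+ a (suc j)) (X-cong a+j+1))) ⟩
  (const 1ℤ ⊖ X (suc N)) ⊛ topProd N j   ≈⟨ ≋-sym (⊛-congˡ≋ (topProd N j) (oneMinusX≋ (suc N))) ⟩
  oneMinusX (suc N) ⊛ topProd N j        ≈⟨ ≋-sym (topProd-top N j j≤N) ⟩
  topProd (suc N) (suc j)                ∎
  where
  open ≋-Reasoning
  a = N ∸ j
  j<N : suc j ≤ N
  j<N = ℕP.≤∧≢⇒< j≤N j≢N
  a+j+1 : a ℕ.+ suc j ≡ suc N
  a+j+1 = trans (ℕP.+-suc a j) (cong suc (ℕP.m∸n+n≡m j≤N))
  distribute : ∀ q b x d → q ⊛ (b ⊕ x ⊛ d) ≋ q ⊛ b ⊕ x ⊛ (q ⊛ d)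
  distribute = solve 4 (λ q b x d → q :* (b :+ x :* d) := q :* b :+ x :* (q :* d)) ≋-refl
  reassoc : ∀ u v w → u ⊛ v ⊛ w ≋ u ⊛ (v ⊛ w)
  reassoc = solve 3 (λ u v w → u :* v :* w := u :* (v :* w)) ≋-refl
  telescope : ∀ xa xb c → (const 1ℤ ⊖ xa) ⊛ c ⊕ xa ⊛ ((const 1ℤ ⊖ xb) ⊛ c) ≋ (const 1ℤ ⊖ xa ⊛ xb) ⊛ c
  telescope = solve 3 (λ xa xb c → (con 1ℤ :- xa) :* c :+ xa :* ((con 1ℤ :- xb) :* c) := (con 1ℤ :- xa :* xb) :* c) ≋-refl

topProd-F₀ : ∀ N j → j ≤ N → topProd N j ⊛ F₀ j ≋ Gauss N j
topProd-F₀ N j le = begin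
  topProd N j ⊛ F₀ j           ≈⟨ ⊛-congˡ≋ (F₀ j) (≋-sym (Poch-Gauss N j le)) ⟩
  Poch j ⊛ Gauss N j ⊛ F₀ j    ≈⟨ exchange (Poch j) (Gauss N j) (F₀ j) ⟩
  Poch j ⊛ F₀ j ⊛ Gauss N j    ≈⟨ ⊛-congˡ≋ (Gauss N j) (Poch-F₀ j) ⟩
  δ ⊛ Gauss N j                ≈⟨ mk≋ (⊛-identityˡ (Gauss N j)) ⟩
  Gauss N j                    ∎
  where
  open ≋-Reasoning
  exchange : ∀ a b d → a ⊛ b ⊛ d ≋ a ⊛ d ⊛ b
  exchange = solve 3 (λ a b d → a :* b :* d := a :* d :* b) ≋-refl

-- The q-Pascal recursion only adds and shifts, so [N, j] ≥ 0.
Nonneg-Gauss : ∀ N j → Nonneg (Gauss N j)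
Nonneg-Gauss N       zero    = Nonneg-δ
Nonneg-Gauss zero    (suc j) n = ℤ.+≤+ z≤n
Nonneg-Gauss (suc N) (suc j) = Nonneg-⊕ (Nonneg-Gauss N (suc j)) (Nonneg-⊛ (X (N ∸ j)) (Gauss N j) (Nonneg-X (N ∸ j)) (Nonneg-Gauss N j))

Σ₀ : ℕ → (ℕ → Ser) → Ser
Σ₀ zero    f = f 0
Σ₀ (suc N) f = f 0 ⊕ Σ₀ N (λ j → f (suc j))

Σ₀-cong : ∀ N f g → (∀ j → j ≤ N → f j ≋ g j) → Σ₀ N f ≋ Σ₀ N g
Σ₀-cong zero    f g e = e 0 z≤n
Σ₀-cong (suc N) f g e = ⊕-cong (e 0 z≤n) (Σ₀-cong N _ _ (λ j le → e (suc j) (s≤s le)))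

Σ₀-⊕ : ∀ N f g → Σ₀ N (λ j → f j ⊕ g j) ≋ Σ₀ N f ⊕ Σ₀ N g
Σ₀-⊕ zero    f g = ≋-refl
Σ₀-⊕ (suc N) f g = begin
  f 0 ⊕ g 0 ⊕ Σ₀ N (λ j → f (suc j) ⊕ g (suc j))          ≈⟨ ⊕-congʳ≋ (f 0 ⊕ g 0) (Σ₀-⊕ N (λ j → f (suc j)) (λ j → g (suc j))) ⟩
  f 0 ⊕ g 0 ⊕ (Σ₀ N (λ j → f (suc j)) ⊕ Σ₀ N (λ j → g (suc j))) ≈⟨ interchange (f 0) (g 0) _ _ ⟩
  f 0 ⊕ Σ₀ N (λ j → f (suc j)) ⊕ (g 0 ⊕ Σ₀ N (λ j → g (suc j))) ∎
  where
  open ≋-Reasoning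
  interchange : ∀ a b c d → a ⊕ b ⊕ (c ⊕ d) ≋ a ⊕ c ⊕ (b ⊕ d)
  interchange = solve 4 (λ a b c d → a :+ b :+ (c :+ d) := a :+ c :+ (b :+ d)) ≋-refl

Σ₀-⊛ : ∀ N a f → Σ₀ N (λ j → a ⊛ f j) ≋ a ⊛ Σ₀ N f
Σ₀-⊛ zero    a f = ≋-refl
Σ₀-⊛ (suc N) a f = ≋-trans (⊕-congʳ≋ (a ⊛ f 0) (Σ₀-⊛ N a (λ j → f (suc j))))
                           (≋-sym (mk≋ (⊛-distribˡ a (f 0) (Σ₀ N (λ j → f (suc j))))))

Σ₀-last : ∀ N f → Σ₀ (suc N) f ≋ Σ₀ N f ⊕ f (suc N)
Σ₀-last zero    f = ≋-refl
Σ₀-last (suc N) f = ≋-trans (⊕-congʳ≋ (f 0) (Σ₀-last N (λ j → f (suc j))))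
                            (mk≋ (λ n → sym (ℤP.+-assoc (f 0 n) _ _)))

Σ₀-at : ∀ N f n → Σ₀ N f n ≡ f 0 n + Σ∈ (squareSizes N) (λ j → f j n)
Σ₀-at zero    f n = sym (ℤP.+-identityʳ (f 0 n))
Σ₀-at (suc N) f n = cong (f 0 n +_) (trans (Σ₀-at N (λ j → f (suc j)) n) (sym
  (trans (Σ∈-map suc (upTo (suc N)) (λ j → f j n))
         (cong (f 1 n +_) (trans (Σ∈-applyUpTo suc N (λ j → f (suc j) n)) (sym (Σ∈-map suc (upTo N) (λ j → f (suc j) n))))))))

DurfeeSum : ℕ → ℕ → Ser
DurfeeSum k N = Σ₀ N (λ j → X (j ℕ.* j ℕ.+ k ℕ.* j) ⊛ Gauss N j ⊛ F₀ (j ℕ.+ k))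

exponent-shift : ∀ N j k → j ≤ N →
  (suc j ℕ.* suc j ℕ.+ k ℕ.* suc j) ℕ.+ (N ∸ j) ≡ suc (N ℕ.+ k) ℕ.+ (j ℕ.* j ℕ.+ suc k ℕ.* j)
exponent-shift N j k le =
  subst (λ M → (suc j ℕ.* suc j ℕ.+ k ℕ.* suc j) ℕ.+ (M ∸ j) ≡ suc (M ℕ.+ k) ℕ.+ (j ℕ.* j ℕ.+ suc k ℕ.* j))
        (ℕP.m+[n∸m]≡n le)
        (trans (cong ((suc j ℕ.* suc j ℕ.+ k ℕ.* suc j) ℕ.+_) (ℕP.m+n∸m≡n j (N ∸ j))) (ring j (N ∸ j) k))
  where
  ring : ∀ j d k → (suc j ℕ.* suc j ℕ.+ k ℕ.* suc j) ℕ.+ d ≡ suc ((j ℕ.+ d) ℕ.+ k) ℕ.+ (j ℕ.* j ℕ.+ suc k ℕ.* j)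
  ring = ℕ-Ring.solve-∀

DurfeeSum-split : ∀ N k j → j ≤ N →
  X (suc j ℕ.* suc j ℕ.+ k ℕ.* suc j) ⊛ Gauss (suc N) (suc j) ⊛ F₀ (suc j ℕ.+ k) ≋
  X (suc j ℕ.* suc j ℕ.+ k ℕ.* suc j) ⊛ Gauss N (suc j) ⊛ F₀ (suc j ℕ.+ k) ⊕
  X (suc (N ℕ.+ k)) ⊛ (X (j ℕ.* j ℕ.+ suc k ℕ.* j) ⊛ Gauss N j ⊛ F₀ (j ℕ.+ suc k))
DurfeeSum-split N k j le = begin
  X e₁ ⊛ (Gauss N (suc j) ⊕ X (N ∸ j) ⊛ Gauss N j) ⊛ F₀ (suc j ℕ.+ k)
    ≈⟨ regroup (X e₁) (Gauss N (suc j)) (X (N ∸ j)) (Gauss N j) (F₀ (suc j ℕ.+ k)) ⟩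
  X e₁ ⊛ Gauss N (suc j) ⊛ F₀ (suc j ℕ.+ k) ⊕ X e₁ ⊛ X (N ∸ j) ⊛ Gauss N j ⊛ F₀ (suc j ℕ.+ k)
    ≈⟨ ⊕-congʳ≋ (X e₁ ⊛ Gauss N (suc j) ⊛ F₀ (suc j ℕ.+ k))
         (⊛-cong (⊛-congˡ≋ (Gauss N j) (≋-trans (X-+ e₁ (N ∸ j)) (≋-trans (X-cong (exponent-shift N j k le))
                                                                        (≋-sym (X-+ (suc (N ℕ.+ k)) e₂)))))
                 (F₀-cong (sym (ℕP.+-suc j k)))) ⟩
  X e₁ ⊛ Gauss N (suc j) ⊛ F₀ (suc j ℕ.+ k) ⊕ X (suc (N ℕ.+ k)) ⊛ X e₂ ⊛ Gauss N j ⊛ F₀ (j ℕ.+ suc k)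
    ≈⟨ ⊕-congʳ≋ (X e₁ ⊛ Gauss N (suc j) ⊛ F₀ (suc j ℕ.+ k)) (reassoc (X (suc (N ℕ.+ k))) (X e₂) (Gauss N j) (F₀ (j ℕ.+ suc k))) ⟩
  X e₁ ⊛ Gauss N (suc j) ⊛ F₀ (suc j ℕ.+ k) ⊕ X (suc (N ℕ.+ k)) ⊛ (X e₂ ⊛ Gauss N j ⊛ F₀ (j ℕ.+ suc k)) ∎
  where
  open ≋-Reasoning
  e₁ = suc j ℕ.* suc j ℕ.+ k ℕ.* suc j
  e₂ = j ℕ.* j ℕ.+ suc k ℕ.* j
  regroup : ∀ x b y d p → x ⊛ (b ⊕ y ⊛ d) ⊛ p ≋ x ⊛ b ⊛ p ⊕ x ⊛ y ⊛ d ⊛ p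
  regroup = solve 5 (λ x b y d p → x :* (b :+ y :* d) :* p := x :* b :* p :+ x :* y :* d :* p) ≋-refl
  reassoc : ∀ a b d p → a ⊛ b ⊛ d ⊛ p ≋ a ⊛ (b ⊛ d ⊛ p)
  reassoc = solve 4 (λ a b d p → a :* b :* d :* p := a :* (b :* d :* p)) ≋-refl

-- Induction on N: the split terms reassemble into DurfeeSum k N and
-- q^{N+k+1} DurfeeSum (k+1) N, and F₀ (N+k+1) = F₀ (N+k) + q^{N+k+1} F₀ (N+k+1).
DurfeeSum≋F₀ : ∀ N k → DurfeeSum k N ≋ F₀ (N ℕ.+ k)
DurfeeSum≋F₀ zero k = begin
  X (0 ℕ.* 0 ℕ.+ k ℕ.* 0) ⊛ δ ⊛ F₀ k  ≈⟨ ⊛-congˡ≋ (F₀ k) (≋-trans (mk≋ (λ n → trans (⊛-comm _ δ n) (⊛-identityˡ _ n)))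
                                                         (≋-trans (X-cong (ℕP.*-zeroʳ k)) X-zero)) ⟩
  δ ⊛ F₀ k                            ≈⟨ mk≋ (⊛-identityˡ (F₀ k)) ⟩
  F₀ k                                ∎
  where open ≋-Reasoning
DurfeeSum≋F₀ (suc N) k = begin
  term (suc N) 0 ⊕ Σ₀ N (λ j → term (suc N) (suc j))
    ≈⟨ ⊕-congʳ≋ (term (suc N) 0) (≋-trans (Σ₀-cong N _ _ (λ j le → DurfeeSum-split N k j le)) (Σ₀-⊕ N _ _)) ⟩
  term N 0 ⊕ (Σ₀ N (λ j → term N (suc j)) ⊕ Σ₀ N (λ j → X (suc (N ℕ.+ k)) ⊛ shifted j))
    ≈⟨ reassoc (term N 0) _ _ ⟩
  Σ₀ (suc N) (term N) ⊕ Σ₀ N (λ j → X (suc (N ℕ.+ k)) ⊛ shifted j)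
    ≈⟨ ⊕-cong (≋-trans (Σ₀-last N (term N)) (≋-trans (⊕-cong (DurfeeSum≋F₀ N k) last-vanishes)
                                                                        (mk≋ {F₀ (N ℕ.+ k) ⊕ 𝟘} (λ n → ℤP.+-identityʳ (F₀ (N ℕ.+ k) n)))))
              (≋-trans (Σ₀-⊛ N (X (suc (N ℕ.+ k))) shifted)
                       (⊛-congʳ≋ (X (suc (N ℕ.+ k))) (≋-trans (DurfeeSum≋F₀ N (suc k)) (F₀-cong (ℕP.+-suc N k))))) ⟩
  F₀ (N ℕ.+ k) ⊕ X (suc (N ℕ.+ k)) ⊛ F₀ (suc (N ℕ.+ k))
    ≈⟨ ≋-sym (F₀-suc (N ℕ.+ k)) ⟩
  F₀ (suc (N ℕ.+ k)) ∎
  where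
  open ≋-Reasoning
  term : ℕ → ℕ → Ser
  term M j = X (j ℕ.* j ℕ.+ k ℕ.* j) ⊛ Gauss M j ⊛ F₀ (j ℕ.+ k)
  shifted : ℕ → Ser
  shifted j = X (j ℕ.* j ℕ.+ suc k ℕ.* j) ⊛ Gauss N j ⊛ F₀ (j ℕ.+ suc k)
  reassoc : ∀ a b c → a ⊕ (b ⊕ c) ≋ a ⊕ b ⊕ c
  reassoc = solve 3 (λ a b c → a :+ (b :+ c) := a :+ b :+ c) ≋-refl
  last-vanishes : term N (suc N) ≋ 𝟘
  last-vanishes = ≋-trans (⊛-congˡ≋ (F₀ (suc N ℕ.+ k)) (⊛-congʳ≋ (X (suc N ℕ.* suc N ℕ.+ k ℕ.* suc N))
                                                                (≋-trans (Gauss-vanish N (suc N) (ℕP.n<1+n N)) (≋-sym const-zero))))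
                  (≋-trans (solve 2 (λ a b → a :* con 0ℤ :* b := con 0ℤ) ≋-refl (X (suc N ℕ.* suc N ℕ.+ k ℕ.* suc N)) (F₀ (suc N ℕ.+ k)))
                           const-zero)

DurfeeTerm : ℕ → ℕ → Ser
DurfeeTerm N j = X (j ℕ.* j) ⊛ Gauss N j ⊛ F₀ j

F₀-dissection : ∀ N → F₀ N ≋ Σ₀ N (DurfeeTerm N)
F₀-dissection N = ≋-sym (begin
  Σ₀ N (DurfeeTerm N)  ≈⟨ Σ₀-cong N _ _ (λ j _ → ⊛-cong (⊛-congˡ≋ (Gauss N j) (X-cong (exponent j))) (F₀-cong (sym (ℕP.+-identityʳ j)))) ⟩
  DurfeeSum 0 N        ≈⟨ DurfeeSum≋F₀ N 0 ⟩
  F₀ (N ℕ.+ 0)         ≈⟨ F₀-cong (ℕP.+-identityʳ N) ⟩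
  F₀ N                 ∎)
  where
  open ≋-Reasoning
  exponent : ∀ j → j ℕ.* j ≡ j ℕ.* j ℕ.+ 0 ℕ.* j
  exponent j = sym (ℕP.+-identityʳ (j ℕ.* j))

Nonneg-F₀ : ∀ j → Nonneg (F₀ j)
Nonneg-F₀ j n = Σ∈-nonneg (filter (bounded? j) (partitions n)) (λ _ → 1ℤ) (λ _ _ → ℤ.+≤+ z≤n)

Nonneg-DurfeeTerm : ∀ N j → Nonneg (DurfeeTerm N j)
Nonneg-DurfeeTerm N j =
  Nonneg-⊛ (X (j ℕ.* j) ⊛ Gauss N j) (F₀ j) (Nonneg-⊛ (X (j ℕ.* j)) (Gauss N j) (Nonneg-X (j ℕ.* j)) (Nonneg-Gauss N j)) (Nonneg-F₀ j)

Geom-unfold : ∀ j n → Geom j n ≡ const 1ℤ n + sh (suc j) (Geom j) n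
Geom-unfold j n = trans (at geometric n) (cong (const 1ℤ n +_) (sym (sh≈X⊛ (suc j) (Geom j) n)))
  where
  open ≋-Reasoning
  geometric : Geom j ≋ const 1ℤ ⊕ X (suc j) ⊛ Geom j
  geometric = begin
    Geom j                                          ≈⟨ split (Geom j) (X (suc j)) ⟩
    (const 1ℤ ⊖ X (suc j)) ⊛ Geom j ⊕ X (suc j) ⊛ Geom j
      ≈⟨ ⊕-congˡ≋ (X (suc j) ⊛ Geom j) (≋-trans (⊛-congˡ≋ (Geom j) (≋-sym (oneMinusX≋ (suc j)))) (Geom-inverse j)) ⟩
    const 1ℤ ⊕ X (suc j) ⊛ Geom j                   ∎
    where
    split : ∀ h x → h ≋ (const 1ℤ ⊖ x) ⊛ h ⊕ x ⊛ h
    split = solve 2 (λ h x → h := (con 1ℤ :- x) :* h :+ x :* h) ≋-refl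

Nonneg-Geom : ∀ j → Nonneg (Geom j)
Nonneg-Geom j = <-rec (λ n → 0ℤ ℤ.≤ Geom j n) step
  where
  step : ∀ n → (∀ {m} → m ℕ.< n → 0ℤ ℤ.≤ Geom j m) → 0ℤ ℤ.≤ Geom j n
  step n IH = subst (0ℤ ℤ.≤_) (sym (Geom-unfold j n)) (ℤP.+-mono-≤ (nonneg-* {1ℤ} (ℤ.+≤+ z≤n) (Nonneg-δ n)) shifted)
    where
    shifted : 0ℤ ℤ.≤ sh (suc j) (Geom j) n
    shifted with suc j ℕP.≤? n
    ... | yes j<n = IH (ℕP.∸-monoʳ-< {o = 0} (s≤s z≤n) j<n)
    ... | no _    = ℤP.≤-refl

Geom-zero : ∀ n → Geom 0 n ≡ 1ℤ
Geom-zero zero    = trans (Geom-unfold 0 0) (cong (1ℤ +_) (sh-suc-at0 0 (Geom 0)))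
Geom-zero (suc n) = trans (Geom-unfold 0 (suc n)) (trans (cong (0ℤ +_) (sh-yes 1 (Geom 0) (suc n) (s≤s z≤n)))
                                                        (trans (ℤP.+-identityˡ _) (Geom-zero n)))

ones : Ser
ones _ = 1ℤ

ones⊛ones : ∀ m → (ones ⊛ ones) m ≡ ℤ.+ suc m
ones⊛ones zero    = refl
ones⊛ones (suc m) = cong (1ℤ +_) (ones⊛ones m)

Lambert-one : ∀ n → Lambert 1 n ≡ ℤ.+ n
Lambert-one n = trans (ℤP.+-identityˡ _) (trans (sym (sh≈X⊛ 1 (Geom 0 ⊛ Geom 0) n)) (shifted n))
  where
  shifted : ∀ n → sh 1 (Geom 0 ⊛ Geom 0) n ≡ ℤ.+ n
  shifted zero    = sh-suc-at0 0 (Geom 0 ⊛ Geom 0)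
  shifted (suc m) = trans (sh-yes 1 (Geom 0 ⊛ Geom 0) (suc m) (s≤s z≤n))
    (trans (⊛-congˡ (Geom 0) ones (Geom 0) Geom-zero m) (trans (⊛-congʳ ones (Geom 0) ones Geom-zero m) (ones⊛ones m)))

Lambert-increase-by : ∀ d j → Nonneg (Lambert (d ℕ.+ j) ⊖ Lambert j)
Lambert-increase-by zero    j n = subst (0ℤ ℤ.≤_) (sym (ℤP.+-inverseʳ (Lambert j n))) ℤP.≤-refl
Lambert-increase-by (suc d) j n =
  subst (0ℤ ℤ.≤_) (sym (regroup (Lambert (d ℕ.+ j) n) (Lambert j n) _))
        (ℤP.+-mono-≤ (Lambert-increase-by d j n)
                     (Nonneg-⊛ (X (suc (d ℕ.+ j))) (Geom (d ℕ.+ j) ⊛ Geom (d ℕ.+ j)) (Nonneg-X (suc (d ℕ.+ j)))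
                               (Nonneg-⊛ (Geom (d ℕ.+ j)) (Geom (d ℕ.+ j)) (Nonneg-Geom (d ℕ.+ j)) (Nonneg-Geom (d ℕ.+ j))) n))
  where
  regroup : ∀ a b c → (a + c) - b ≡ (a - b) + c
  regroup = solve-∀

Lambert-mono : ∀ {j N} → j ≤ N → Nonneg (Lambert N ⊖ Lambert j)
Lambert-mono {j} {N} j≤N = subst (λ M → Nonneg (Lambert M ⊖ Lambert j)) (ℕP.m∸n+n≡m j≤N) (Lambert-increase-by (N ∸ j) j)

Lambert-≥ : ∀ N → 1 ≤ N → ∀ n → ℤ.+ n ℤ.≤ Lambert N n
Lambert-≥ N 1≤N n = begin
  ℤ.+ n                                 ≡⟨ sym (Lambert-one n) ⟩
  Lambert 1 n                           ≡⟨ sym (ℤP.+-identityˡ _) ⟩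
  0ℤ + Lambert 1 n                      ≤⟨ ℤP.+-monoˡ-≤ (Lambert 1 n) (Lambert-mono 1≤N n) ⟩
  (Lambert N n - Lambert 1 n) + Lambert 1 n ≡⟨ cancel (Lambert N n) (Lambert 1 n) ⟩
  Lambert N n                           ∎
  where
  open ℤP.≤-Reasoning
  cancel : ∀ a b → (a - b) + b ≡ a
  cancel = solve-∀

M-Lambert : ∀ N → Poch N ⊛ PairMoment N ≋ Lambert N ⊛ F₀ N ⊕ Lambert N ⊛ F₀ N
M-Lambert N = begin
  Poch N ⊛ PairMoment N
    ≈⟨ ⊛-congʳ≋ (Poch N) (≋-trans (PairMoment≋Var N) (⊕-cong (Var≋ N) (Var≋ N))) ⟩
  Poch N ⊛ (F₀ N ⊛ F₀ N ⊛ Lambert N ⊕ F₀ N ⊛ F₀ N ⊛ Lambert N)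
    ≈⟨ regroup (Poch N) (F₀ N) (Lambert N) ⟩
  (Poch N ⊛ F₀ N) ⊛ (Lambert N ⊛ F₀ N) ⊕ (Poch N ⊛ F₀ N) ⊛ (Lambert N ⊛ F₀ N)
    ≈⟨ ⊕-cong (⊛-congˡ≋ (Lambert N ⊛ F₀ N) one) (⊛-congˡ≋ (Lambert N ⊛ F₀ N) one) ⟩
  const 1ℤ ⊛ (Lambert N ⊛ F₀ N) ⊕ const 1ℤ ⊛ (Lambert N ⊛ F₀ N)
    ≈⟨ drop-one (Lambert N ⊛ F₀ N) ⟩
  Lambert N ⊛ F₀ N ⊕ Lambert N ⊛ F₀ N ∎
  where
  open ≋-Reasoning
  one : Poch N ⊛ F₀ N ≋ const 1ℤ
  one = ≋-trans (Poch-F₀ N) (≋-sym const-one)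
  regroup : ∀ q p s → q ⊛ (p ⊛ p ⊛ s ⊕ p ⊛ p ⊛ s) ≋ (q ⊛ p) ⊛ (s ⊛ p) ⊕ (q ⊛ p) ⊛ (s ⊛ p)
  regroup = solve 3 (λ q p s → q :* (p :* p :* s :+ p :* p :* s) := (q :* p) :* (s :* p) :+ (q :* p) :* (s :* p)) ≋-refl
  drop-one : ∀ a → const 1ℤ ⊛ a ⊕ const 1ℤ ⊛ a ≋ a ⊕ a
  drop-one = solve 1 (λ a → con 1ℤ :* a :+ con 1ℤ :* a := a :+ a) ≋-refl

N-Lambert : ∀ N j → j ≤ N → topProd N j ⊛ sh (j ℕ.* j) (PairMoment j) ≋ Lambert j ⊛ DurfeeTerm N j ⊕ Lambert j ⊛ DurfeeTerm N j
N-Lambert N j le = begin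
  topProd N j ⊛ sh (j ℕ.* j) (PairMoment j)
    ≈⟨ ⊛-congʳ≋ (topProd N j) (≋-trans (mk≋ (sh≈X⊛ (j ℕ.* j) (PairMoment j)))
                                      (⊛-congʳ≋ (X (j ℕ.* j)) (≋-trans (PairMoment≋Var j) (⊕-cong (Var≋ j) (Var≋ j))))) ⟩
  topProd N j ⊛ (X (j ℕ.* j) ⊛ (F₀ j ⊛ F₀ j ⊛ Lambert j ⊕ F₀ j ⊛ F₀ j ⊛ Lambert j))
    ≈⟨ regroup (topProd N j) (X (j ℕ.* j)) (F₀ j) (Lambert j) ⟩
  Lambert j ⊛ (X (j ℕ.* j) ⊛ (topProd N j ⊛ F₀ j) ⊛ F₀ j) ⊕ Lambert j ⊛ (X (j ℕ.* j) ⊛ (topProd N j ⊛ F₀ j) ⊛ F₀ j)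
    ≈⟨ ⊕-cong (⊛-congʳ≋ (Lambert j) gauss) (⊛-congʳ≋ (Lambert j) gauss) ⟩
  Lambert j ⊛ DurfeeTerm N j ⊕ Lambert j ⊛ DurfeeTerm N j ∎
  where
  open ≋-Reasoning
  gauss : X (j ℕ.* j) ⊛ (topProd N j ⊛ F₀ j) ⊛ F₀ j ≋ DurfeeTerm N j
  gauss = ⊛-congˡ≋ (F₀ j) (⊛-congʳ≋ (X (j ℕ.* j)) (topProd-F₀ N j le))
  regroup : ∀ c x p s → c ⊛ (x ⊛ (p ⊛ p ⊛ s ⊕ p ⊛ p ⊛ s)) ≋ s ⊛ (x ⊛ (c ⊛ p) ⊛ p) ⊕ s ⊛ (x ⊛ (c ⊛ p) ⊛ p)
  regroup = solve 4 (λ c x p s → c :* (x :* (p :* p :* s :+ p :* p :* s)) := s :* (x :* (c :* p) :* p) :+ s :* (x :* (c :* p) :* p)) ≋-refl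

DurfeeTerm-zero : ∀ N → DurfeeTerm N 0 ≋ δ
DurfeeTerm-zero N = ≋-trans (⊛-cong (⊛-cong X-zero (Gauss-zero N)) F₀-zero)
                            (≋-trans (⊛-congˡ≋ δ (mk≋ (⊛-identityˡ δ))) (mk≋ (⊛-identityˡ δ)))
  where
  Gauss-zero : ∀ N → Gauss N 0 ≋ δ
  Gauss-zero zero    = ≋-refl
  Gauss-zero (suc N) = ≋-refl

twice : ℤ → ℤ
twice x = x + x

M2-dissected : ∀ N n → M2 N n ≡ twice (Lambert N n + Σ∈ (squareSizes N) (λ j → (Lambert N ⊛ DurfeeTerm N j) n))
M2-dissected N n = trans (M2-series N n) (trans (at (M-Lambert N) n) (cong twice dissect))
  where
  dissect : (Lambert N ⊛ F₀ N) n ≡ Lambert N n + Σ∈ (squareSizes N) (λ j → (Lambert N ⊛ DurfeeTerm N j) n)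
  dissect = begin
    (Lambert N ⊛ F₀ N) n                              ≡⟨ at (⊛-congʳ≋ (Lambert N) (F₀-dissection N)) n ⟩
    (Lambert N ⊛ Σ₀ N (DurfeeTerm N)) n               ≡⟨ sym (at (Σ₀-⊛ N (Lambert N) (DurfeeTerm N)) n) ⟩
    Σ₀ N (λ j → Lambert N ⊛ DurfeeTerm N j) n         ≡⟨ Σ₀-at N (λ j → Lambert N ⊛ DurfeeTerm N j) n ⟩
    (Lambert N ⊛ DurfeeTerm N 0) n + _                ≡⟨ cong (_+ Σ∈ (squareSizes N) (λ j → (Lambert N ⊛ DurfeeTerm N j) n))
                                                              (trans (at (⊛-congʳ≋ (Lambert N) (DurfeeTerm-zero N)) n)
                                                                     (trans (⊛-comm (Lambert N) δ n) (⊛-identityˡ (Lambert N) n))) ⟩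
    Lambert N n + Σ∈ (squareSizes N) (λ j → (Lambert N ⊛ DurfeeTerm N j) n) ∎
    where open ≡-Reasoning

N2-dissected : ∀ N n → N2 N n ≡ twice (Σ∈ (squareSizes N) (λ j → (Lambert j ⊛ DurfeeTerm N j) n))
N2-dissected N n =
  trans (N2-series N n)
        (trans (Σ∈-cong (squareSizes N) (λ j j∈ → at (N-Lambert N j (proj₂ (squareSizes-bounds N j j∈))) n))
               (Σ∈-+ (squareSizes N) (λ j → (Lambert j ⊛ DurfeeTerm N j) n) (λ j → (Lambert j ⊛ DurfeeTerm N j) n)))

⊛-monoˡ : ∀ f g h → Nonneg (g ⊖ f) → Nonneg h → ∀ n → (f ⊛ h) n ℤ.≤ (g ⊛ h) n
⊛-monoˡ f g h g-f≥0 h≥0 n = begin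
  (f ⊛ h) n                         ≡⟨ sym (ℤP.+-identityʳ _) ⟩
  (f ⊛ h) n + 0ℤ                    ≤⟨ ℤP.+-monoʳ-≤ ((f ⊛ h) n) (Nonneg-⊛ (g ⊖ f) h g-f≥0 h≥0 n) ⟩
  (f ⊛ h) n + ((g ⊖ f) ⊛ h) n       ≡⟨ sym (at (split f g h) n) ⟩
  (g ⊛ h) n                         ∎
  where
  open ℤP.≤-Reasoning
  split : ∀ f g h → g ⊛ h ≋ f ⊛ h ⊕ (g ⊖ f) ⊛ h
  split = solve 3 (λ f g h → g :* h := f :* h :+ (g :- f) :* h) ≋-refl

term-dominance : ∀ N n → Σ∈ (squareSizes N) (λ j → (Lambert j ⊛ DurfeeTerm N j) n) ℤ.≤
                         Σ∈ (squareSizes N) (λ j → (Lambert N ⊛ DurfeeTerm N j) n)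
term-dominance N n = Σ∈-mono (squareSizes N) _ _ (λ j j∈ →
  ⊛-monoˡ (Lambert j) (Lambert N) (DurfeeTerm N j) (Lambert-mono (proj₂ (squareSizes-bounds N j j∈))) (Nonneg-DurfeeTerm N j) n)

-- With L = Lambert N (n), D_j = DurfeeTerm N j:
--   N₂ = 2 Σ_j (Lambert j · D_j)(n) ≤ 2 Σ_j (Lambert N · D_j)(n) < 2 (L + Σ_j (Lambert N · D_j)(n)) = M₂,
-- the strict step because L ≥ n ≥ 1.

corollary2p5 : (N : ℕ) → 1 ≤ N → (n : ℕ) → 1 ≤ n → N2 N n < M2 N n
corollary2p5 N 1≤N n 1≤n = begin-strict
  N2 N n                                          ≡⟨ N2-dissected N n ⟩
  twice (Σ∈ (squareSizes N) termN)                <⟨ ℤP.+-mono-< smaller smaller ⟩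
  twice (Lambert N n + Σ∈ (squareSizes N) termM)  ≡⟨ sym (M2-dissected N n) ⟩
  M2 N n                                          ∎
  where
  open ℤP.≤-Reasoning
  termN termM : ℕ → ℤ
  termN j = (Lambert j ⊛ DurfeeTerm N j) n
  termM j = (Lambert N ⊛ DurfeeTerm N j) n
  L-positive : 0ℤ ℤ.< Lambert N n
  L-positive = ℤP.<-≤-trans (ℤ.+<+ 1≤n) (Lambert-≥ N 1≤N n)
  smaller : Σ∈ (squareSizes N) termN ℤ.< Lambert N n + Σ∈ (squareSizes N) termM
  smaller = subst (ℤ._< Lambert N n + Σ∈ (squareSizes N) termM) (ℤP.+-identityˡ _)
                  (ℤP.+-mono-<-≤ L-positive (term-dominance N n))
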